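{- Let $n\in\mathbb{N}$, $i\in\mathbb{N}_0$ and $r\in[n]_0$. Then: (a) $\gamma_i^r(n)=0$ if $i<r$ or $i>\langle n\rangle_q$; moreover $\gamma_0^0(n)=1$ and $\gamma_n^n(n)=\frac{1}{n!}\prod_{\ell=0}^{n-1}\frac{q^n-q^\ell}{q-1}$; (b) $\gamma_i^r(n)=\left[{n\atop r}\right]_q\gamma_i^r(r)$; (c) $\sum_{j=0}^n\left[{n\atop j}\right]_q\gamma_i^j(j)=\binom{\langle n\rangle_q}{i}$; (d) $\gamma_i^r(r)=\sum_{j=0}^r\left[{r\atop j}\right]_q(-1)^jq^{\binom{j}{2}}\binom{\langle r-j\rangle_q}{i}$.
   Context: $q$ is a prime power, $\langle s\rangle_q=(q^s-1)/(q-1)$, $[n]_0=\{0,\dots,n\}$, and $\left[{a\atop b}\right]_q$ is the Gaussian binomial (number of $b$-dimensional subspaces of $\mathbb{F}_q^a$). For a finite-dimensional $\mathbb{F}_q$-space $W$, $\mathbb{P}W$ is the set of its one-dimensional subspaces, and for $A\subseteq\mathbb{P}W$, $\langle A\rangle$ is the subspace spanned by the lines in $A$. For integers $i,r\ge0$ and $s\ge0$, $\gamma_i^r(s)=|\{A\subseteq\mathbb{P}W:|A|=i,\ \dim\langle A\rangle=r\}|$ where $W$ is any $s$-dimensional $\mathbb{F}_q$-vector space. -}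

module Defs where

open import Level using (0ℓ)
open import Data.Bool using (Bool; true; false; if_then_else_)
open import Data.Nat using (ℕ; zero; suc; _+_; _*_; _^_)
open import Data.Nat.Combinatorics using (_C_)
open import Data.Integer as ℤ using (ℤ)
open import Data.Fin using (Fin)
open import Data.Fin.Properties using (any?; all?)
open import Data.Fin.Subset using (Subset; ∣_∣)
open import Data.List as List using (List; concatMap; filter; length)
open import Data.Vec as Vec using (Vec; []; _∷_; zipWith; replicate; tabulate; lookup)
open import Data.Vec.Properties using (≡-dec)
open import Data.Vec.Relation.Unary.All as VAll using (All)
open import Data.Product using (Σ; ∃; _×_; _,_; proj₁; proj₂)
open import Data.Sum using (_⊎_; inj₁; inj₂)
open import Data.Empty using (⊥)
open import Relation.Nullary using (¬_; Dec; yes; no; does)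
open import Relation.Nullary.Decidable using (map′; _×-dec_; _⊎-dec_; _→-dec_)
open import Relation.Unary using (Decidable)
open import Relation.Binary.PropositionalEquality using (_≡_; _≢_; refl)
open import Algebra.Structures using (IsCommutativeRing)
import Data.Fin.Properties as FinP

-- A finite field with q elements, carried by Fin q (with propositional
-- equality).  The existence of such a field is equivalent to q being a
-- prime power, and all fields of order q are isomorphic, so this fixes F_q.

record FiniteField (q : ℕ) : Set where
  infixl 6 _+F_
  infixl 7 _*F_
  field
    _+F_ _*F_ : Fin q → Fin q → Fin q
    -F_       : Fin q → Fin q
    0F 1F     : Fin q
    _⁻¹F      : Fin q → Fin q
    isCommutativeRing : IsCommutativeRing _≡_ _+F_ _*F_ -F_ 0F 1F
    0≢1       : 0F ≢ 1F
    ⁻¹-inverse : ∀ x → x ≢ 0F → x *F (x ⁻¹F) ≡ 1F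

∃Vec? : {A : Set} →
        (∀ {P : A → Set} → Decidable P → Dec (∃ P)) →
        ∀ n {P : Vec A n → Set} → Decidable P → Dec (∃ P)
∃Vec? ∃A? zero {P} P? = map′ (λ p → [] , p) (λ { ([] , p) → p }) (P? [])
∃Vec? ∃A? (suc n) {P} P? =
  map′ (λ { (a , v , p) → a ∷ v , p }) (λ { (a ∷ v , p) → a , v , p })
       (∃A? (λ a → ∃Vec? ∃A? n (λ v → P? (a ∷ v))))

∀Vec? : {A : Set} →
        (∀ {P : A → Set} → Decidable P → Dec (∀ a → P a)) →
        ∀ n {P : Vec A n → Set} → Decidable P → Dec (∀ v → P v)
∀Vec? ∀A? zero {P} P? = map′ (λ { p [] → p }) (λ f → f []) (P? [])
∀Vec? ∀A? (suc n) {P} P? =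
  map′ (λ { f (a ∷ v) → f a v }) (λ f a v → f (a ∷ v))
       (∀A? (λ a → ∀Vec? ∀A? n (λ v → P? (a ∷ v))))

countSubsets : ∀ n {P : Subset n → Set} → Decidable P → ℕ
countSubsets zero P? = if does (P? []) then 1 else 0
countSubsets (suc n) P? =
  countSubsets n (λ v → P? (true ∷ v)) + countSubsets n (λ v → P? (false ∷ v))

sumℕ : ℕ → (ℕ → ℕ) → ℕ
sumℕ zero f = f 0
sumℕ (suc n) f = sumℕ n f + f (suc n)

sumℤ : ℕ → (ℕ → ℤ) → ℤ
sumℤ zero f = f 0
sumℤ (suc n) f = sumℤ n f ℤ.+ f (suc n)

prodℕ : ℕ → (ℕ → ℕ) → ℕ
prodℕ zero f = 1
prodℕ (suc n) f = prodℕ n f * f n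

-- ⟨ s ⟩_q = (q^s - 1)/(q - 1) = 1 + q + ... + q^(s-1)
⟨_⟩[_] : ℕ → ℕ → ℕ
⟨ zero ⟩[ q ] = 0
⟨ suc s ⟩[ q ] = ⟨ s ⟩[ q ] + q ^ s

-- Gaussian binomial [a b]_q, via the q-Pascal recursion
-- [a+1, b+1] = [a, b] + q^(b+1) [a, b+1]
gauss : ℕ → ℕ → ℕ → ℕ
gauss q a zero = 1
gauss q zero (suc b) = 0
gauss q (suc a) (suc b) = gauss q a b + q ^ suc b * gauss q a (suc b)

module _ {q : ℕ} (F : FiniteField q) where
  open FiniteField F

  Vecq : ℕ → Set
  Vecq s = Vec (Fin q) s

  ∃F? : ∀ {P : Fin q → Set} → Decidable P → Dec (∃ P)
  ∃F? = any?

  ∀F? : ∀ {P : Fin q → Set} → Decidable P → Dec (∀ a → P a)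
  ∀F? = all?

  ∃V? : ∀ s {P : Vecq s → Set} → Decidable P → Dec (∃ P)
  ∃V? s = ∃Vec? ∃F? s

  ∀V? : ∀ s {P : Vecq s → Set} → Decidable P → Dec (∀ v → P v)
  ∀V? s = ∀Vec? ∀F? s

  _≟V_ : ∀ {s} (u v : Vecq s) → Dec (u ≡ v)
  _≟V_ = ≡-dec FinP._≟_

  zeroV : ∀ {s} → Vecq s
  zeroV = replicate _ 0F

  _+V_ : ∀ {s} → Vecq s → Vecq s → Vecq s
  _+V_ = zipWith _+F_

  _·V_ : ∀ {s} → Fin q → Vecq s → Vecq s
  c ·V v = Vec.map (c *F_) v

  lincomb : ∀ {s r} → Vec (Fin q) r → Vec (Vecq s) r → Vecq s
  lincomb [] [] = zeroV
  lincomb (c ∷ cs) (b ∷ bs) = (c ·V b) +V lincomb cs bs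

  allVecs : ∀ s → List (Vecq s)
  allVecs zero = [] List.∷ List.[]
  allVecs (suc s) = concatMap (λ a → List.map (a ∷_) (allVecs s)) (List.allFin q)

  -- A nonzero vector whose first nonzero coordinate is 1.  Every
  -- one-dimensional subspace of F_q^s contains exactly one such vector,
  -- so these vectors represent the points of ℙ(F_q^s) bijectively.
  Normalized : ∀ {s} → Vecq s → Set
  Normalized [] = ⊥
  Normalized (x ∷ v) = (x ≡ 1F) ⊎ (x ≡ 0F × Normalized v)

  normalized? : ∀ {s} → Decidable (Normalized {s})
  normalized? [] = no (λ ())
  normalized? (x ∷ v) = (x FinP.≟ 1F) ⊎-dec ((x FinP.≟ 0F) ×-dec normalized? v)

  points : ∀ s → List (Vecq s)
  points s = filter normalized? (allVecs s)

  |ℙ| : ℕ → ℕ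
  |ℙ| s = length (points s)

  point : ∀ s → Fin (|ℙ| s) → Vecq s
  point s = List.lookup (points s)

  InSpan : ∀ s → Subset (|ℙ| s) → Vecq s → Set
  InSpan s A u =
    Σ (Vec (Fin q) (|ℙ| s)) λ c →
      (∀ k → lookup A k ≡ false → lookup c k ≡ 0F) ×
      lincomb c (tabulate (point s)) ≡ u

  inSpan? : ∀ s A → Decidable (InSpan s A)
  inSpan? s A u = ∃V? (|ℙ| s) (λ c →
     all? (λ k → (lookup A k Data.Bool.≟ false) →-dec (lookup c k FinP.≟ 0F))
     ×-dec (lincomb c (tabulate (point s)) ≟V u))
    where import Data.Bool

  LinIndep : ∀ {s r} → Vec (Vecq s) r → Set
  LinIndep {s} {r} b = ∀ (c : Vec (Fin q) r) → lincomb c b ≡ zeroV → c ≡ replicate r 0F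

  linIndep? : ∀ {s r} → Decidable (LinIndep {s} {r})
  linIndep? {s} {r} b = ∀V? r (λ c → (lincomb c b ≟V zeroV) →-dec (c ≟V replicate r 0F))

  HasDim : ∀ s (U : Vecq s → Set) → Decidable U → ℕ → Set
  HasDim s U U? r =
    Σ (Vec (Vecq s) r) λ b →
      All U b × LinIndep b ×
      (∀ u → U u → Σ (Vec (Fin q) r) λ c → lincomb c b ≡ u)

  hasDim? : ∀ s U (U? : Decidable U) r → Dec (HasDim s U U? r)
  hasDim? s U U? r = ∃Vec? (∃V? s) r (λ b →
     VAll.all? U? b ×-dec linIndep? b ×-dec
     ∀V? s (λ u → U? u →-dec ∃V? r (λ c → lincomb c b ≟V u)))

  IsΓ : ∀ i r s → Subset (|ℙ| s) → Set
  IsΓ i r s A = ∣ A ∣ ≡ i × HasDim s (InSpan s A) (inSpan? s A) r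

  isΓ? : ∀ i r s → Decidable (IsΓ i r s)
  isΓ? i r s A = (∣ A ∣ Data.Nat.≟ i) ×-dec hasDim? s (InSpan s A) (inSpan? s A) r
    where import Data.Nat

  γ : ℕ → ℕ → ℕ → ℕ
  γ i r s = countSubsets (|ℙ| s) (isΓ? i r s)

{-# OPTIONS --safe #-}

-- A set A of points of ℙ(F_q^n) spans a subspace ⟨A⟩ whose dimension r is read off from
-- |⟨A⟩| = q^r.  For (b), double count the pairs (A , b) with b an ordered basis of ⟨A⟩:
-- an r-dimensional ⟨A⟩ has ∏_{ℓ<r} (q^r - q^ℓ) ordered bases, and for a fixed independent
-- r-tuple b the injective map c ↦ Σ c_k b_k carries the spanning i-sets of ℙ(F_q^r)
-- bijectively onto the i-sets spanning ⟨b⟩; as there are ∏_{ℓ<r} (q^n - q^ℓ), which is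
-- [n r]_q ∏_{ℓ<r} (q^r - q^ℓ), independent r-tuples, γ_i^r(n) = [n r]_q γ_i^r(r).
-- Summing (b) over r counts each i-subset of the ⟨n⟩_q points once, which is (c), and
-- (d) is q-binomial inversion of (c), via Σ_j (-1)^j q^(j choose 2) [m j]_q = [m = 0].
-- For γ_n^n(n), deleting a marked point of an independent (i+1)-set leaves an independent
-- i-set and a point outside its span, so (i+1) γ_{i+1}^{i+1}(n) = (⟨n⟩_q - ⟨i⟩_q) γ_i^i(n).

module Submission where

open import Function using (_∘_; id; case_of_)
open import Data.Empty using (⊥-elim)
open import Data.Unit using (⊤; tt)
open import Data.Bool using (Bool; true; false; if_then_else_)
import Data.Bool.Properties as Boolₚ
open import Data.Nat using (ℕ; zero; suc; _+_; _*_; _∸_; _^_; _≤_; _<_; s≤s; z≤n; _!; NonZero; >-nonZero)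
open import Data.Nat.Properties
open import Data.Nat.Combinatorics using (_C_; nCk+nC[k+1]≡[n+1]C[k+1]; nC1≡n)
open import Data.Nat.Tactic.RingSolver using (solve-∀)
open import Data.Product using (Σ; _×_; _,_; proj₁; proj₂)
import Data.Product.Properties as Productₚ
open import Data.Sum using (_⊎_; inj₁; inj₂)
open import Data.List as List using (List; []; _∷_; _++_; concatMap; length; allFin)
import Data.List.Properties as Listₚ
open import Data.Vec using (Vec; []; _∷_; lookup; replicate; tabulate; _[_]≔_)
import Data.Vec.Properties as Vecₚ
import Data.Vec.Relation.Unary.All.Properties as Allₚ
open import Data.Vec.Relation.Unary.All as All using (All; []; _∷_)
open import Data.Fin using (Fin; zero; suc)
import Data.Fin.Properties as Finₚ
open import Data.Fin.Subset using (Subset; ∣_∣)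
import Data.Fin.Subset.Properties as Subsetₚ
open import Relation.Nullary using (¬_; Dec; yes; no; does)
open import Relation.Nullary.Decidable using (_×-dec_; _→-dec_; _⊎-dec_; ¬?; decidable-stable)
open import Relation.Unary using (Decidable)
open import Relation.Binary.Definitions using (DecidableEquality; tri<; tri≈; tri>)
open import Relation.Binary.PropositionalEquality
open import Algebra.Bundles using (CommutativeRing)
open import Algebra.Structures using (IsCommutativeRing)
import Algebra.Properties.Ring as RingProperties
open import Defs

module Counting where

  𝟙 : {P : Set} → Dec P → ℕ
  𝟙 (yes _) = 1
  𝟙 (no _)  = 0

  𝟙≤1 : {P : Set} (p : Dec P) → 𝟙 p ≤ 1
  𝟙≤1 (yes _) = s≤s z≤n
  𝟙≤1 (no _)  = z≤n

  𝟙-if : {P : Set} (p : Dec P) → (if does p then 1 else 0) ≡ 𝟙 p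
  𝟙-if (yes _) = refl
  𝟙-if (no _)  = refl

  𝟙-yes : {P : Set} → P → (p : Dec P) → 𝟙 p ≡ 1
  𝟙-yes x (yes _) = refl
  𝟙-yes x (no ¬x) = ⊥-elim (¬x x)

  𝟙-no : {P : Set} → ¬ P → (p : Dec P) → 𝟙 p ≡ 0
  𝟙-no ¬x (yes x) = ⊥-elim (¬x x)
  𝟙-no ¬x (no _)  = refl

  𝟙-cong : {P Q : Set} → (P → Q) → (Q → P) → (p : Dec P) (q : Dec Q) → 𝟙 p ≡ 𝟙 q
  𝟙-cong f g (yes p) q       = sym (𝟙-yes (f p) q)
  𝟙-cong f g (no ¬p) (yes q) = ⊥-elim (¬p (g q))
  𝟙-cong f g (no ¬p) (no _)  = refl

  𝟙-× : {P Q : Set} (p : Dec P) (q : Dec Q) → 𝟙 (p ×-dec q) ≡ 𝟙 p * 𝟙 q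
  𝟙-× (yes p) (yes q) = refl
  𝟙-× (yes p) (no ¬q) = refl
  𝟙-× (no ¬p) q       = refl

  𝟙-split : {P Q : Set} (q : Dec Q) (p : Dec P) →
            𝟙 q ≡ 𝟙 (q ×-dec p) + 𝟙 (q ×-dec ¬? p)
  𝟙-split (yes q) (yes p) = refl
  𝟙-split (yes q) (no ¬p) = refl
  𝟙-split (no ¬q) p       = sym (cong₂ _+_ (𝟙-no (¬q ∘ proj₁) (no ¬q ×-dec p))
                                           (𝟙-no (¬q ∘ proj₁) (no ¬q ×-dec ¬? p)))

  𝟙-*-cong : {P : Set} (p : Dec P) {x y : ℕ} → (P → x ≡ y) → 𝟙 p * x ≡ 𝟙 p * y
  𝟙-*-cong (yes p) f = cong (1 *_) (f p)
  𝟙-*-cong (no _)  f = refl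

  ∑ : {X : Set} → List X → (X → ℕ) → ℕ
  ∑ []       f = 0
  ∑ (x ∷ xs) f = f x + ∑ xs f

  ∑-cong : {X : Set} (xs : List X) {f g : X → ℕ} → (∀ x → f x ≡ g x) → ∑ xs f ≡ ∑ xs g
  ∑-cong []       e = refl
  ∑-cong (x ∷ xs) e = cong₂ _+_ (e x) (∑-cong xs e)

  ∑-zero : {X : Set} (xs : List X) → ∑ xs (λ _ → 0) ≡ 0
  ∑-zero []       = refl
  ∑-zero (x ∷ xs) = ∑-zero xs

  ∑-const : {X : Set} (xs : List X) (c : ℕ) → ∑ xs (λ _ → c) ≡ length xs * c
  ∑-const []       c = refl
  ∑-const (x ∷ xs) c = cong (c +_) (∑-const xs c)

  ∑-mono : {X : Set} (xs : List X) {f g : X → ℕ} → (∀ x → f x ≤ g x) → ∑ xs f ≤ ∑ xs g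
  ∑-mono []       e = z≤n
  ∑-mono (x ∷ xs) e = +-mono-≤ (e x) (∑-mono xs e)

  ∑-distrib-+ : {X : Set} (xs : List X) (f g : X → ℕ) → ∑ xs (λ x → f x + g x) ≡ ∑ xs f + ∑ xs g
  ∑-distrib-+ []       f g = refl
  ∑-distrib-+ (x ∷ xs) f g = begin
    (f x + g x) + ∑ xs (λ x → f x + g x) ≡⟨ cong ((f x + g x) +_) (∑-distrib-+ xs f g) ⟩
    (f x + g x) + (∑ xs f + ∑ xs g)      ≡⟨ interchange (f x) (g x) (∑ xs f) (∑ xs g) ⟩
    (f x + ∑ xs f) + (g x + ∑ xs g)      ∎
    where
    open ≡-Reasoning
    interchange : ∀ a b c d → (a + b) + (c + d) ≡ (a + c) + (b + d)
    interchange = solve-∀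

  ∑-*ˡ : {X : Set} (xs : List X) (c : ℕ) (f : X → ℕ) → ∑ xs (λ x → c * f x) ≡ c * ∑ xs f
  ∑-*ˡ []       c f = sym (*-zeroʳ c)
  ∑-*ˡ (x ∷ xs) c f = trans (cong (c * f x +_) (∑-*ˡ xs c f)) (sym (*-distribˡ-+ c (f x) (∑ xs f)))

  ∑-*ʳ : {X : Set} (xs : List X) (c : ℕ) (f : X → ℕ) → ∑ xs (λ x → f x * c) ≡ ∑ xs f * c
  ∑-*ʳ xs c f = trans (∑-cong xs (λ x → *-comm (f x) c)) (trans (∑-*ˡ xs c f) (*-comm c _))

  ∑-++ : {X : Set} (xs ys : List X) (f : X → ℕ) → ∑ (xs ++ ys) f ≡ ∑ xs f + ∑ ys f
  ∑-++ []       ys f = refl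
  ∑-++ (x ∷ xs) ys f = trans (cong (f x +_) (∑-++ xs ys f)) (sym (+-assoc (f x) _ _))

  ∑-comm : {X Y : Set} (xs : List X) (ys : List Y) (f : X → Y → ℕ) →
           ∑ xs (λ x → ∑ ys (f x)) ≡ ∑ ys (λ y → ∑ xs (λ x → f x y))
  ∑-comm []       ys f = sym (∑-zero ys)
  ∑-comm (x ∷ xs) ys f = trans (cong (∑ ys (f x) +_) (∑-comm xs ys f))
                               (sym (∑-distrib-+ ys (f x) (λ y → ∑ xs (λ x → f x y))))

  ∑-map : {X Y : Set} (g : X → Y) (xs : List X) (f : Y → ℕ) → ∑ (List.map g xs) f ≡ ∑ xs (f ∘ g)
  ∑-map g []       f = refl
  ∑-map g (x ∷ xs) f = cong (f (g x) +_) (∑-map g xs f)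

  ∑-concatMap : {X Y : Set} (g : X → List Y) (xs : List X) (f : Y → ℕ) →
                ∑ (concatMap g xs) f ≡ ∑ xs (λ x → ∑ (g x) f)
  ∑-concatMap g []       f = refl
  ∑-concatMap g (x ∷ xs) f = trans (∑-++ (g x) (concatMap g xs) f)
                                   (cong (∑ (g x) f +_) (∑-concatMap g xs f))

  ∑-filter : {X : Set} {P : X → Set} (P? : Decidable P) (xs : List X) (f : X → ℕ) →
             ∑ (List.filter P? xs) f ≡ ∑ xs (λ x → 𝟙 (P? x) * f x)
  ∑-filter P? []       f = refl
  ∑-filter P? (x ∷ xs) f with P? x
  ... | yes _ = cong₂ _+_ (sym (+-identityʳ (f x))) (∑-filter P? xs f)
  ... | no _  = ∑-filter P? xs f

  ∑-allFin-suc : ∀ n (f : Fin (suc n) → ℕ) → ∑ (allFin (suc n)) f ≡ f zero + ∑ (allFin n) (f ∘ suc)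
  ∑-allFin-suc n f =
    cong (f zero +_) (trans (cong (λ xs → ∑ xs f) (sym (Listₚ.map-tabulate id suc))) (∑-map suc (allFin n) f))

  ∑-lookup : {X : Set} (xs : List X) (f : X → ℕ) → ∑ xs f ≡ ∑ (allFin (length xs)) (f ∘ List.lookup xs)
  ∑-lookup []       f = refl
  ∑-lookup (x ∷ xs) f = trans (cong (f x +_) (∑-lookup xs f)) (sym (∑-allFin-suc (length xs) (f ∘ List.lookup (x ∷ xs))))

  ∑-lookup-≤ : {X : Set} (xs : List X) (f : X → ℕ) (i : Fin (length xs)) → f (List.lookup xs i) ≤ ∑ xs f
  ∑-lookup-≤ (x ∷ xs) f zero    = m≤m+n _ _
  ∑-lookup-≤ (x ∷ xs) f (suc i) = ≤-trans (∑-lookup-≤ xs f i) (m≤n+m _ (f x))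

  ∑-lookup₂-≤ : {X : Set} (xs : List X) (f : X → ℕ) (i j : Fin (length xs)) → i ≢ j →
                f (List.lookup xs i) + f (List.lookup xs j) ≤ ∑ xs f
  ∑-lookup₂-≤ (x ∷ xs) f zero    zero    i≢j = ⊥-elim (i≢j refl)
  ∑-lookup₂-≤ (x ∷ xs) f zero    (suc j) i≢j = +-monoʳ-≤ (f x) (∑-lookup-≤ xs f j)
  ∑-lookup₂-≤ (x ∷ xs) f (suc i) zero    i≢j =
    subst (_≤ f x + ∑ xs f) (+-comm (f x) _) (+-monoʳ-≤ (f x) (∑-lookup-≤ xs f i))
  ∑-lookup₂-≤ (x ∷ xs) f (suc i) (suc j) i≢j =
    ≤-trans (∑-lookup₂-≤ xs f i j (i≢j ∘ cong suc)) (m≤n+m _ (f x))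

  sumℕ-cong : ∀ n {f g : ℕ → ℕ} → (∀ j → j ≤ n → f j ≡ g j) → sumℕ n f ≡ sumℕ n g
  sumℕ-cong zero    e = e 0 z≤n
  sumℕ-cong (suc n) e = cong₂ _+_ (sumℕ-cong n (λ j j≤n → e j (m≤n⇒m≤1+n j≤n))) (e (suc n) ≤-refl)

  sumℕ-zero : ∀ n (f : ℕ → ℕ) → (∀ j → j ≤ n → f j ≡ 0) → sumℕ n f ≡ 0
  sumℕ-zero zero    f e = e 0 z≤n
  sumℕ-zero (suc n) f e = cong₂ _+_ (sumℕ-zero n f (λ j j≤n → e j (m≤n⇒m≤1+n j≤n))) (e (suc n) ≤-refl)

  sumℕ-*ˡ : ∀ n c (f : ℕ → ℕ) → sumℕ n (λ j → c * f j) ≡ c * sumℕ n f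
  sumℕ-*ˡ zero    c f = refl
  sumℕ-*ˡ (suc n) c f = trans (cong (_+ c * f (suc n)) (sumℕ-*ˡ n c f)) (sym (*-distribˡ-+ c _ _))

  sumℕ-∑-comm : ∀ n {X : Set} (xs : List X) (f : ℕ → X → ℕ) →
                sumℕ n (λ j → ∑ xs (f j)) ≡ ∑ xs (λ x → sumℕ n (λ j → f j x))
  sumℕ-∑-comm zero    xs f = refl
  sumℕ-∑-comm (suc n) xs f = trans (cong (_+ ∑ xs (f (suc n))) (sumℕ-∑-comm n xs f)) (sym (∑-distrib-+ xs _ _))

  sumℕ-𝟙-≟ : ∀ n m → m ≤ n → sumℕ n (λ j → 𝟙 (j ≟ m)) ≡ 1
  sumℕ-𝟙-≟ zero    zero    z≤n = refl
  sumℕ-𝟙-≟ (suc n) m m≤1+n with m ≤? n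
  ... | yes m≤n = trans (cong₂ _+_ (sumℕ-𝟙-≟ n m m≤n) (𝟙-no (λ 1+n≡m → <-irrefl (sym 1+n≡m) (s≤s m≤n)) (suc n ≟ m)))
                        (+-identityʳ 1)
  ... | no m≰n  = cong₂ _+_ (sumℕ-zero n _ (λ j j≤n → 𝟙-no (λ j≡m → m≰n (subst (_≤ n) j≡m j≤n)) (j ≟ m)))
                           (𝟙-yes (≤-antisym (≰⇒> m≰n) m≤1+n) (suc n ≟ m))

  record Enumeration (X : Set) : Set where
    field
      elements : List X
      decEq    : DecidableEquality X
      once     : ∀ x → ∑ elements (λ y → 𝟙 (decEq y x)) ≡ 1

  module Count {X : Set} (E : Enumeration X) where
    open Enumeration E

    count : {P : X → Set} → Decidable P → ℕ
    count P? = ∑ elements (λ x → 𝟙 (P? x))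

    ∑-select : ∀ x (g : X → ℕ) → ∑ elements (λ y → 𝟙 (decEq y x) * g y) ≡ g x
    ∑-select x g = begin
      ∑ elements (λ y → 𝟙 (decEq y x) * g y) ≡⟨ ∑-cong elements at-x ⟩
      ∑ elements (λ y → 𝟙 (decEq y x) * g x) ≡⟨ ∑-*ʳ elements (g x) _ ⟩
      ∑ elements (λ y → 𝟙 (decEq y x)) * g x ≡⟨ cong (_* g x) (once x) ⟩
      1 * g x                                ≡⟨ *-identityˡ (g x) ⟩
      g x                                    ∎
      where
      open ≡-Reasoning
      at-x : ∀ y → 𝟙 (decEq y x) * g y ≡ 𝟙 (decEq y x) * g x
      at-x y with decEq y x
      ... | yes refl = refl
      ... | no _     = refl

    term≤∑ : ∀ x (g : X → ℕ) → g x ≤ ∑ elements g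
    term≤∑ x g = subst (_≤ ∑ elements g) (∑-select x g) (∑-mono elements 𝟙*g≤g)
      where
      𝟙*g≤g : ∀ y → 𝟙 (decEq y x) * g y ≤ g y
      𝟙*g≤g y with decEq y x
      ... | yes _ = ≤-reflexive (+-identityʳ (g y))
      ... | no _  = z≤n

    module _ {P Q : X → Set} (P? : Decidable P) (Q? : Decidable Q) where

      count-cong : (∀ x → P x → Q x) → (∀ x → Q x → P x) → count P? ≡ count Q?
      count-cong f g = ∑-cong elements (λ x → 𝟙-cong (f x) (g x) (P? x) (Q? x))

      count-mono : (∀ x → P x → Q x) → count P? ≤ count Q?
      count-mono f = ∑-mono elements 𝟙-mono
        where
        𝟙-mono : ∀ x → 𝟙 (P? x) ≤ 𝟙 (Q? x)
        𝟙-mono x with P? x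
        ... | yes p = ≤-reflexive (sym (𝟙-yes (f x p) (Q? x)))
        ... | no _  = z≤n

      count-split : count P? ≡ count (λ x → P? x ×-dec Q? x) + count (λ x → P? x ×-dec ¬? (Q? x))
      count-split = trans (∑-cong elements (λ x → 𝟙-split (P? x) (Q? x))) (∑-distrib-+ elements _ _)

    module _ {P : X → Set} (P? : Decidable P) where

      count-none : (∀ x → ¬ P x) → count P? ≡ 0
      count-none f = trans (∑-cong elements (λ x → 𝟙-no (f x) (P? x))) (∑-zero elements)

      count-all : (∀ x → P x) → count P? ≡ length elements
      count-all f = trans (∑-cong elements (λ x → 𝟙-yes (f x) (P? x)))
                          (trans (∑-const elements 1) (*-identityʳ _))

      count-single : ∀ x → P x → (∀ y → P y → y ≡ x) → count P? ≡ 1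
      count-single x px f = trans (∑-cong elements (λ y → 𝟙-cong (f y) (λ { refl → px }) (P? y) (decEq y x)))
                                  (once x)

      count-pos : ∀ x → P x → 0 < count P?
      count-pos x px = subst (_≤ count P?) (𝟙-yes px (P? x)) (term≤∑ x (λ y → 𝟙 (P? y)))

    count-≤⇒⊇ : {P Q : X → Set} (P? : Decidable P) (Q? : Decidable Q) →
                (∀ x → P x → Q x) → count Q? ≤ count P? → ∀ x → Q x → P x
    count-≤⇒⊇ P? Q? P⊆Q Q≤P x qx with P? x
    ... | yes p = p
    ... | no ¬p = ⊥-elim (<⇒≱ P<Q Q≤P)
      where
      open ≤-Reasoning
      P<Q : count P? < count Q?
      P<Q = begin-strict
        count P?                          ≡⟨ count-cong P? (λ y → Q? y ×-dec P? y) (λ y p → P⊆Q y p , p) (λ _ → proj₂) ⟩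
        count (λ y → Q? y ×-dec P? y)     <⟨ m<m+n _ (count-pos (λ y → Q? y ×-dec ¬? (P? y)) x (qx , ¬p)) ⟩
        count (λ y → Q? y ×-dec P? y) + count (λ y → Q? y ×-dec ¬? (P? y)) ≡⟨ sym (count-split Q? P?) ⟩
        count Q?                          ∎

  open Count public

  module CountAlongMaps {X Y : Set} (EX : Enumeration X) (EY : Enumeration Y)
                        {P : X → Set} {Q : Y → Set} (P? : Decidable P) (Q? : Decidable Q)
                        (g : X → Y) where
    open Enumeration EX using () renaming (elements to xs; decEq to _≟X_; once to onceX)
    open Enumeration EY using () renaming (elements to ys; decEq to _≟Y_; once to onceY)

    private
      fibres : ∑ ys (λ y → ∑ xs (λ x → 𝟙 (P? x) * 𝟙 (g x ≟Y y))) ≡ count EX P?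
      fibres = trans (sym (∑-comm xs ys _)) (∑-cong xs one-fibre)
        where
        one-fibre : ∀ x → ∑ ys (λ y → 𝟙 (P? x) * 𝟙 (g x ≟Y y)) ≡ 𝟙 (P? x)
        one-fibre x = begin
          ∑ ys (λ y → 𝟙 (P? x) * 𝟙 (g x ≟Y y)) ≡⟨ ∑-*ˡ ys (𝟙 (P? x)) _ ⟩
          𝟙 (P? x) * ∑ ys (λ y → 𝟙 (g x ≟Y y)) ≡⟨ cong (𝟙 (P? x) *_) (∑-cong ys (λ y → 𝟙-cong sym sym (g x ≟Y y) (y ≟Y g x))) ⟩
          𝟙 (P? x) * ∑ ys (λ y → 𝟙 (y ≟Y g x)) ≡⟨ cong (𝟙 (P? x) *_) (onceY (g x)) ⟩
          𝟙 (P? x) * 1                         ≡⟨ *-identityʳ _ ⟩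
          𝟙 (P? x)                             ∎
          where open ≡-Reasoning

      𝟙-fibre : ∀ {y} x → P x → g x ≡ y → 𝟙 (P? x) * 𝟙 (g x ≟Y y) ≡ 1
      𝟙-fibre {y} x px gx≡y = trans (sym (𝟙-× (P? x) (g x ≟Y y))) (𝟙-yes (px , gx≡y) _)

    count-≤-surjection : (∀ {y} → Q y → Σ X (λ x → P x × g x ≡ y)) → count EY Q? ≤ count EX P?
    count-≤-surjection surj = subst (count EY Q? ≤_) fibres (∑-mono ys fibre-inhabited)
      where
      fibre-inhabited : ∀ y → 𝟙 (Q? y) ≤ ∑ xs (λ x → 𝟙 (P? x) * 𝟙 (g x ≟Y y))
      fibre-inhabited y with Q? y
      ... | no _   = z≤n
      ... | yes qy with surj qy
      ...   | x , px , gx≡y = subst (_≤ ∑ xs (λ x → 𝟙 (P? x) * 𝟙 (g x ≟Y y))) (𝟙-fibre x px gx≡y)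
                                  (term≤∑ EX x (λ x → 𝟙 (P? x) * 𝟙 (g x ≟Y y)))

    count-bijection : (∀ {x x'} → P x → P x' → g x ≡ g x' → x ≡ x') →
                      (∀ {x} → P x → Q (g x)) →
                      (∀ {y} → Q y → Σ X (λ x → P x × g x ≡ y)) →
                      count EY Q? ≡ count EX P?
    count-bijection inj pres surj = trans (∑-cong ys fibre-size) fibres
      where
      fibre-size : ∀ y → 𝟙 (Q? y) ≡ ∑ xs (λ x → 𝟙 (P? x) * 𝟙 (g x ≟Y y))
      fibre-size y with Q? y
      ... | yes qy with surj qy
      ...   | x₀ , px₀ , gx₀≡y = sym (trans (∑-cong xs is-x₀) (onceX x₀))
        where
        is-x₀ : ∀ x → 𝟙 (P? x) * 𝟙 (g x ≟Y y) ≡ 𝟙 (x ≟X x₀)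
        is-x₀ x = trans (sym (𝟙-× (P? x) (g x ≟Y y)))
          (𝟙-cong (λ (px , gx≡y) → inj px px₀ (trans gx≡y (sym gx₀≡y))) (λ { refl → px₀ , gx₀≡y }) _ _)
      fibre-size y | no ¬qy = sym (trans (∑-cong xs empty) (∑-zero xs))
        where
        empty : ∀ x → 𝟙 (P? x) * 𝟙 (g x ≟Y y) ≡ 0
        empty x = trans (sym (𝟙-× (P? x) (g x ≟Y y)))
                        (𝟙-no (λ (px , gx≡y) → ¬qy (subst Q gx≡y (pres px))) _)

  module Pairs {X Y Z : Set} (EX : Enumeration X) (EY : Enumeration Y) (pair : X → Y → Z) where
    open Enumeration EX using () renaming (elements to xs; decEq to _≟X_; once to onceX)
    open Enumeration EY using () renaming (elements to ys; decEq to _≟Y_; once to onceY)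

    pairs : List Z
    pairs = concatMap (λ x → List.map (pair x) ys) xs

    ∑-pairs : (f : Z → ℕ) → ∑ pairs f ≡ ∑ xs (λ x → ∑ ys (λ y → f (pair x y)))
    ∑-pairs f = trans (∑-concatMap _ xs f) (∑-cong xs (λ x → ∑-map (pair x) ys f))

    once-pairs : (_≟Z_ : DecidableEquality Z) →
                 (∀ {x y x' y'} → pair x' y' ≡ pair x y → x' ≡ x × y' ≡ y) →
                 ∀ x y → ∑ pairs (λ z → 𝟙 (z ≟Z pair x y)) ≡ 1
    once-pairs _≟Z_ pair-injective x y = begin
      ∑ pairs (λ z → 𝟙 (z ≟Z pair x y))                               ≡⟨ ∑-pairs _ ⟩
      ∑ xs (λ x' → ∑ ys (λ y' → 𝟙 (pair x' y' ≟Z pair x y)))          ≡⟨ ∑-cong xs (λ x' → ∑-cong ys (λ y' → split x' y')) ⟩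
      ∑ xs (λ x' → ∑ ys (λ y' → 𝟙 (x' ≟X x) * 𝟙 (y' ≟Y y)))         ≡⟨ ∑-cong xs (λ x' → ∑-*ˡ ys (𝟙 (x' ≟X x)) _) ⟩
      ∑ xs (λ x' → 𝟙 (x' ≟X x) * ∑ ys (λ y' → 𝟙 (y' ≟Y y)))         ≡⟨ ∑-cong xs (λ x' → cong (𝟙 (x' ≟X x) *_) (onceY y)) ⟩
      ∑ xs (λ x' → 𝟙 (x' ≟X x) * 1)                                  ≡⟨ ∑-*ʳ xs 1 _ ⟩
      ∑ xs (λ x' → 𝟙 (x' ≟X x)) * 1                                  ≡⟨ cong (_* 1) (onceX x) ⟩
      1                                                                ∎
      where
      open ≡-Reasoning
      split : ∀ x' y' → 𝟙 (pair x' y' ≟Z pair x y) ≡ 𝟙 (x' ≟X x) * 𝟙 (y' ≟Y y)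
      split x' y' = trans (𝟙-cong pair-injective (λ { (refl , refl) → refl }) _ ((x' ≟X x) ×-dec (y' ≟Y y)))
                          (𝟙-× (x' ≟X x) (y' ≟Y y))

  open Pairs using (∑-pairs) public

  enumBool : Enumeration Bool
  enumBool = record { elements = true ∷ false ∷ [] ; decEq = Boolₚ._≟_ ; once = λ { true → refl ; false → refl } }

  enumFin : ∀ n → Enumeration (Fin n)
  enumFin n = record { elements = allFin n ; decEq = Finₚ._≟_ ; once = once n }
    where
    once : ∀ n (x : Fin n) → ∑ (allFin n) (λ y → 𝟙 (y Finₚ.≟ x)) ≡ 1
    once (suc n) zero    = trans (∑-allFin-suc n (λ y → 𝟙 (y Finₚ.≟ zero)))
      (cong suc (trans (∑-cong (allFin n) (λ k → 𝟙-no (λ ()) (suc k Finₚ.≟ zero))) (∑-zero (allFin n))))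
    once (suc n) (suc x) = trans (∑-allFin-suc n (λ y → 𝟙 (y Finₚ.≟ suc x)))
      (trans (∑-cong (allFin n) (λ k → 𝟙-cong Finₚ.suc-injective (cong suc) (suc k Finₚ.≟ suc x) (k Finₚ.≟ x)))
             (once n x))

  enum× : {X Y : Set} → Enumeration X → Enumeration Y → Enumeration (X × Y)
  enum× EX EY = record
    { elements = Pairs.pairs EX EY _,_
    ; decEq    = _≟×_
    ; once     = λ (x , y) → Pairs.once-pairs EX EY _,_ _≟×_ (λ { refl → refl , refl }) x y }
    where
    _≟×_ : DecidableEquality _
    _≟×_ = Productₚ.≡-dec (Enumeration.decEq EX) (Enumeration.decEq EY)

  enumVec : {X : Set} → Enumeration X → ∀ n → Enumeration (Vec X n)
  enumVec EX zero    = record { elements = [] ∷ [] ; decEq = λ { [] [] → yes refl } ; once = λ { [] → refl } }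
  enumVec EX (suc n) = record
    { elements = Pairs.pairs EX (enumVec EX n) _∷_
    ; decEq    = _≟ᵥ_
    ; once     = λ { (x ∷ v) → Pairs.once-pairs EX (enumVec EX n) _∷_ _≟ᵥ_ Vecₚ.∷-injective x v } }
    where
    _≟ᵥ_ : DecidableEquality (Vec _ (suc n))
    _≟ᵥ_ = Vecₚ.≡-dec (Enumeration.decEq EX)

module Subsets where
  open Counting

  enumSubset : ∀ n → Enumeration (Subset n)
  enumSubset = enumVec enumBool

  countSubsets≡count : ∀ n {P : Subset n → Set} (P? : Decidable P) → countSubsets n P? ≡ count (enumSubset n) P?
  countSubsets≡count zero    P? = trans (𝟙-if (P? [])) (sym (+-identityʳ _))
  countSubsets≡count (suc n) P? = begin
    countSubsets n (λ v → P? (true ∷ v)) + countSubsets n (λ v → P? (false ∷ v))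
      ≡⟨ cong₂ _+_ (countSubsets≡count n _) (countSubsets≡count n _) ⟩
    count (enumSubset n) (λ v → P? (true ∷ v)) + count (enumSubset n) (λ v → P? (false ∷ v))
      ≡⟨ cong (count (enumSubset n) (λ v → P? (true ∷ v)) +_) (sym (+-identityʳ _)) ⟩
    ∑ (true ∷ false ∷ []) (λ b → count (enumSubset n) (λ v → P? (b ∷ v)))
      ≡⟨ sym (∑-pairs enumBool (enumSubset n) _∷_ (λ A → 𝟙 (P? A))) ⟩
    count (enumSubset (suc n)) P? ∎
    where open ≡-Reasoning

  ∣_∣≡count : ∀ {n} (A : Subset n) → ∣ A ∣ ≡ count (enumFin n) (λ k → lookup A k Boolₚ.≟ true)
  ∣ []     ∣≡count = refl
  ∣ b ∷ A  ∣≡count = trans (head b) (sym (∑-allFin-suc _ (λ k → 𝟙 (lookup (b ∷ A) k Boolₚ.≟ true))))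
    where
    head : ∀ b → ∣ b ∷ A ∣ ≡ 𝟙 (b Boolₚ.≟ true) + count (enumFin _) (λ k → lookup A k Boolₚ.≟ true)
    head true  = cong suc ∣ A ∣≡count
    head false = ∣ A ∣≡count

  count-∣∣≡ : ∀ n i → count (enumSubset n) (λ A → ∣ A ∣ ≟ i) ≡ n C i
  count-∣∣≡ zero    zero    = refl
  count-∣∣≡ zero    (suc i) = refl
  count-∣∣≡ (suc n) i       = begin
    count (enumSubset (suc n)) (λ A → ∣ A ∣ ≟ i)
      ≡⟨ ∑-pairs enumBool (enumSubset n) _∷_ (λ A → 𝟙 (∣ A ∣ ≟ i)) ⟩
    count (enumSubset n) (λ A → suc ∣ A ∣ ≟ i) + (count (enumSubset n) (λ A → ∣ A ∣ ≟ i) + 0)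
      ≡⟨ cong (count (enumSubset n) (λ A → suc ∣ A ∣ ≟ i) +_) (+-identityʳ _) ⟩
    count (enumSubset n) (λ A → suc ∣ A ∣ ≟ i) + count (enumSubset n) (λ A → ∣ A ∣ ≟ i)
      ≡⟨ pascal i ⟩
    suc n C i ∎
    where
    open ≡-Reasoning
    pascal : ∀ i → count (enumSubset n) (λ A → suc ∣ A ∣ ≟ i) + count (enumSubset n) (λ A → ∣ A ∣ ≟ i) ≡ suc n C i
    pascal zero    = cong₂ _+_ (count-none (enumSubset n) (λ A → suc ∣ A ∣ ≟ 0) (λ A ())) (count-∣∣≡ n 0)
    pascal (suc i) = begin
      count (enumSubset n) (λ A → suc ∣ A ∣ ≟ suc i) + count (enumSubset n) (λ A → ∣ A ∣ ≟ suc i)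
        ≡⟨ cong (_+ count (enumSubset n) (λ A → ∣ A ∣ ≟ suc i))
                (count-cong (enumSubset n) _ (λ A → ∣ A ∣ ≟ i) (λ _ → suc-injective) (λ _ → cong suc)) ⟩
      count (enumSubset n) (λ A → ∣ A ∣ ≟ i) + count (enumSubset n) (λ A → ∣ A ∣ ≟ suc i)
        ≡⟨ cong₂ _+_ (count-∣∣≡ n i) (count-∣∣≡ n (suc i)) ⟩
      n C i + n C suc i
        ≡⟨ nCk+nC[k+1]≡[n+1]C[k+1] n i ⟩
      suc n C suc i ∎

  ∣∣≡0⇒≡⊥ : ∀ {n} (A : Subset n) → ∣ A ∣ ≡ 0 → A ≡ replicate n false
  ∣∣≡0⇒≡⊥ []          _  = refl
  ∣∣≡0⇒≡⊥ (true ∷ A)  ()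
  ∣∣≡0⇒≡⊥ (false ∷ A) e  = cong (false ∷_) (∣∣≡0⇒≡⊥ A e)

  ∣[]≔true∣ : ∀ {n} (A : Subset n) k → lookup A k ≡ false → ∣ A [ k ]≔ true ∣ ≡ suc ∣ A ∣
  ∣[]≔true∣ (false ∷ A) zero    _ = refl
  ∣[]≔true∣ (true ∷ A)  (suc k) e = cong suc (∣[]≔true∣ A k e)
  ∣[]≔true∣ (false ∷ A) (suc k) e = ∣[]≔true∣ A k e

  []≔-restore : ∀ {n} (A : Subset n) k {x y} → lookup A k ≡ x → (A [ k ]≔ y) [ k ]≔ x ≡ A
  []≔-restore A k {x} e = trans (Vecₚ.[]≔-idempotent A k) (trans (cong (A [ k ]≔_) (sym e)) (Vecₚ.[]≔-lookup A k))

module LinearAlgebra {q : ℕ} (F : FiniteField q) where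
  open Counting
  open FiniteField F
  module R = IsCommutativeRing isCommutativeRing

  private
    ring : CommutativeRing _ _
    ring = record { isCommutativeRing = isCommutativeRing }
  open RingProperties (CommutativeRing.ring ring) using (-1*x≈-x; -‿involutive)

  V : ℕ → Set
  V = Vecq F

  infixl 6 _⊕_
  infixl 7 _⊙_

  _⊕_ : ∀ {s} → V s → V s → V s
  _⊕_ = _+V_ F

  _⊙_ : ∀ {s} → Fin q → V s → V s
  _⊙_ = _·V_ F

  𝟎 : ∀ {s} → V s
  𝟎 = zeroV F

  lc : ∀ {s r} → Vec (Fin q) r → Vec (V s) r → V s
  lc = lincomb F

  -1F : Fin q
  -1F = -F 1F

  1≢0 : 1F ≢ 0F
  1≢0 = 0≢1 ∘ sym

  -1*x+x≡0 : ∀ x → -1F *F x +F x ≡ 0F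
  -1*x+x≡0 x = trans (cong (_+F x) (-1*x≈-x x)) (R.-‿inverseˡ x)

  -1*-1≡1 : -1F *F -1F ≡ 1F
  -1*-1≡1 = trans (-1*x≈-x -1F) (-‿involutive 1F)

  -1≢0 : -1F ≢ 0F
  -1≢0 e = 1≢0 (trans (sym -1*-1≡1) (trans (cong (-1F *F_) e) (R.zeroʳ -1F)))

  ⁻¹-inverseˡ : ∀ x → x ≢ 0F → x ⁻¹F *F x ≡ 1F
  ⁻¹-inverseˡ x x≢0 = trans (R.*-comm _ x) (⁻¹-inverse x x≢0)

  *-nonzero : ∀ {a b} → a ≢ 0F → b ≢ 0F → a *F b ≢ 0F
  *-nonzero {a} {b} a≢0 b≢0 ab≡0 = a≢0 (begin
    a                     ≡⟨ sym (R.*-identityʳ a) ⟩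
    a *F 1F               ≡⟨ cong (a *F_) (sym (⁻¹-inverse b b≢0)) ⟩
    a *F (b *F b ⁻¹F)     ≡⟨ sym (R.*-assoc a b _) ⟩
    (a *F b) *F b ⁻¹F     ≡⟨ cong (_*F b ⁻¹F) ab≡0 ⟩
    0F *F b ⁻¹F           ≡⟨ R.zeroˡ _ ⟩
    0F                    ∎)
    where open ≡-Reasoning

  ⁻¹-nonzero : ∀ {a} → a ≢ 0F → a ⁻¹F ≢ 0F
  ⁻¹-nonzero {a} a≢0 e = 0≢1 (trans (sym (R.zeroʳ a)) (trans (cong (a *F_) (sym e)) (⁻¹-inverse a a≢0)))

  ⊕-assoc : ∀ {s} (u v w : V s) → (u ⊕ v) ⊕ w ≡ u ⊕ (v ⊕ w)
  ⊕-assoc []      []      []      = refl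
  ⊕-assoc (a ∷ u) (b ∷ v) (c ∷ w) = cong₂ _∷_ (R.+-assoc a b c) (⊕-assoc u v w)

  ⊕-comm : ∀ {s} (u v : V s) → u ⊕ v ≡ v ⊕ u
  ⊕-comm []      []      = refl
  ⊕-comm (a ∷ u) (b ∷ v) = cong₂ _∷_ (R.+-comm a b) (⊕-comm u v)

  ⊕-identityˡ : ∀ {s} (u : V s) → 𝟎 ⊕ u ≡ u
  ⊕-identityˡ []      = refl
  ⊕-identityˡ (a ∷ u) = cong₂ _∷_ (R.+-identityˡ a) (⊕-identityˡ u)

  ⊕-identityʳ : ∀ {s} (u : V s) → u ⊕ 𝟎 ≡ u
  ⊕-identityʳ u = trans (⊕-comm u 𝟎) (⊕-identityˡ u)

  ⊕-interchange : ∀ {s} (a b c d : V s) → (a ⊕ b) ⊕ (c ⊕ d) ≡ (a ⊕ c) ⊕ (b ⊕ d)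
  ⊕-interchange a b c d = begin
    (a ⊕ b) ⊕ (c ⊕ d) ≡⟨ ⊕-assoc a b (c ⊕ d) ⟩
    a ⊕ (b ⊕ (c ⊕ d)) ≡⟨ cong (a ⊕_) (sym (⊕-assoc b c d)) ⟩
    a ⊕ ((b ⊕ c) ⊕ d) ≡⟨ cong (λ x → a ⊕ (x ⊕ d)) (⊕-comm b c) ⟩
    a ⊕ ((c ⊕ b) ⊕ d) ≡⟨ cong (a ⊕_) (⊕-assoc c b d) ⟩
    a ⊕ (c ⊕ (b ⊕ d)) ≡⟨ sym (⊕-assoc a c (b ⊕ d)) ⟩
    (a ⊕ c) ⊕ (b ⊕ d) ∎
    where open ≡-Reasoning

  ⊙-distribˡ-⊕ : ∀ {s} a (u v : V s) → a ⊙ (u ⊕ v) ≡ a ⊙ u ⊕ a ⊙ v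
  ⊙-distribˡ-⊕ a []      []      = refl
  ⊙-distribˡ-⊕ a (x ∷ u) (y ∷ v) = cong₂ _∷_ (R.distribˡ a x y) (⊙-distribˡ-⊕ a u v)

  ⊙-distribʳ-+ : ∀ {s} a b (u : V s) → (a +F b) ⊙ u ≡ a ⊙ u ⊕ b ⊙ u
  ⊙-distribʳ-+ a b []      = refl
  ⊙-distribʳ-+ a b (x ∷ u) = cong₂ _∷_ (R.distribʳ x a b) (⊙-distribʳ-+ a b u)

  ⊙-assoc : ∀ {s} a b (u : V s) → (a *F b) ⊙ u ≡ a ⊙ (b ⊙ u)
  ⊙-assoc a b []      = refl
  ⊙-assoc a b (x ∷ u) = cong₂ _∷_ (R.*-assoc a b x) (⊙-assoc a b u)

  ⊙-identityˡ : ∀ {s} (u : V s) → 1F ⊙ u ≡ u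
  ⊙-identityˡ []      = refl
  ⊙-identityˡ (x ∷ u) = cong₂ _∷_ (R.*-identityˡ x) (⊙-identityˡ u)

  ⊙-zeroˡ : ∀ {s} (u : V s) → 0F ⊙ u ≡ 𝟎
  ⊙-zeroˡ []      = refl
  ⊙-zeroˡ (x ∷ u) = cong₂ _∷_ (R.zeroˡ x) (⊙-zeroˡ u)

  ⊙-zeroʳ : ∀ {s} a → a ⊙ 𝟎 {s} ≡ 𝟎
  ⊙-zeroʳ {zero}  a = refl
  ⊙-zeroʳ {suc s} a = cong₂ _∷_ (R.zeroʳ a) (⊙-zeroʳ a)

  ⊕-inverseˡ : ∀ {s} (u : V s) → -1F ⊙ u ⊕ u ≡ 𝟎
  ⊕-inverseˡ []      = refl
  ⊕-inverseˡ (x ∷ u) = cong₂ _∷_ (-1*x+x≡0 x) (⊕-inverseˡ u)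

  ⊕-cancelʳ : ∀ {s} (u v w : V s) → u ⊕ w ≡ v ⊕ w → u ≡ v
  ⊕-cancelʳ u v w e = begin
    u                       ≡⟨ sym (⊕-identityʳ u) ⟩
    u ⊕ 𝟎                   ≡⟨ cong (u ⊕_) (sym w-w≡𝟎) ⟩
    u ⊕ (w ⊕ -1F ⊙ w)       ≡⟨ sym (⊕-assoc u w _) ⟩
    (u ⊕ w) ⊕ -1F ⊙ w       ≡⟨ cong (_⊕ -1F ⊙ w) e ⟩
    (v ⊕ w) ⊕ -1F ⊙ w       ≡⟨ ⊕-assoc v w _ ⟩
    v ⊕ (w ⊕ -1F ⊙ w)       ≡⟨ cong (v ⊕_) w-w≡𝟎 ⟩
    v ⊕ 𝟎                   ≡⟨ ⊕-identityʳ v ⟩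
    v                       ∎
    where
    open ≡-Reasoning
    w-w≡𝟎 : w ⊕ -1F ⊙ w ≡ 𝟎
    w-w≡𝟎 = trans (⊕-comm w _) (⊕-inverseˡ w)

  ⊕≡𝟎⇒≡-1⊙ : ∀ {s} (u v : V s) → u ⊕ v ≡ 𝟎 → u ≡ -1F ⊙ v
  ⊕≡𝟎⇒≡-1⊙ u v e = ⊕-cancelʳ u (-1F ⊙ v) v (trans e (sym (⊕-inverseˡ v)))

  -1⊙-involutive : ∀ {s} (u : V s) → -1F ⊙ (-1F ⊙ u) ≡ u
  -1⊙-involutive u = trans (sym (⊙-assoc -1F -1F u)) (trans (cong (_⊙ u) -1*-1≡1) (⊙-identityˡ u))

  lc-𝟎 : ∀ {s r} (b : Vec (V s) r) → lc 𝟎 b ≡ 𝟎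
  lc-𝟎 []      = refl
  lc-𝟎 (x ∷ b) = trans (cong₂ _⊕_ (⊙-zeroˡ x) (lc-𝟎 b)) (⊕-identityˡ 𝟎)

  lc-⊕ : ∀ {s r} (c c' : Vec (Fin q) r) (b : Vec (V s) r) → lc (c ⊕ c') b ≡ lc c b ⊕ lc c' b
  lc-⊕ []      []       []      = sym (⊕-identityˡ 𝟎)
  lc-⊕ (x ∷ c) (y ∷ c') (u ∷ b) =
    trans (cong₂ _⊕_ (⊙-distribʳ-+ x y u) (lc-⊕ c c' b)) (⊕-interchange _ _ _ _)

  lc-⊙ : ∀ {s r} a (c : Vec (Fin q) r) (b : Vec (V s) r) → lc (a ⊙ c) b ≡ a ⊙ lc c b
  lc-⊙ a []      []      = sym (⊙-zeroʳ a)
  lc-⊙ a (x ∷ c) (u ∷ b) = trans (cong₂ _⊕_ (⊙-assoc a x u) (lc-⊙ a c b)) (sym (⊙-distribˡ-⊕ a _ _))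

  unitVec : ∀ {r} → Fin r → Vec (Fin q) r
  unitVec zero    = 1F ∷ 𝟎
  unitVec (suc k) = 0F ∷ unitVec k

  lc-unitVec : ∀ {s r} (k : Fin r) (b : Vec (V s) r) → lc (unitVec k) b ≡ lookup b k
  lc-unitVec zero    (u ∷ b) = trans (cong₂ _⊕_ (⊙-identityˡ u) (lc-𝟎 b)) (⊕-identityʳ u)
  lc-unitVec (suc k) (u ∷ b) = trans (cong₂ _⊕_ (⊙-zeroˡ u) (lc-unitVec k b)) (⊕-identityˡ _)

  lookup-unitVec : ∀ {r} (k k' : Fin r) → k' ≢ k → lookup (unitVec k) k' ≡ 0F
  lookup-unitVec zero    zero     k'≢k = ⊥-elim (k'≢k refl)
  lookup-unitVec zero    (suc k') _    = Vecₚ.lookup-replicate k' 0F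
  lookup-unitVec (suc k) zero     _    = refl
  lookup-unitVec (suc k) (suc k') k'≢k = lookup-unitVec k k' (k'≢k ∘ cong suc)

  record IsSubspace {s} (W : V s → Set) : Set where
    field
      0∈ : W 𝟎
      +∈ : ∀ {u v} → W u → W v → W (u ⊕ v)
      ·∈ : ∀ a {u} → W u → W (a ⊙ u)

  open IsSubspace public

  lc-∈ : ∀ {s r} {W : V s → Set} → IsSubspace W → (c : Vec (Fin q) r) (b : Vec (V s) r) → All W b → W (lc c b)
  lc-∈ sub [] [] [] = 0∈ sub
  lc-∈ sub (x ∷ c) (u ∷ b) (wu ∷ wb) = +∈ sub (·∈ sub x wu) (lc-∈ sub c b wb)

  Span : ∀ {s r} → Vec (V s) r → V s → Set
  Span {r = r} b u = Σ (Vec (Fin q) r) λ c → lc c b ≡ u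

  span? : ∀ {s r} (b : Vec (V s) r) → Decidable (Span b)
  span? {r = r} b u = ∃V? F r (λ c → _≟V_ F (lc c b) u)

  Span-∋ : ∀ {s r} (b : Vec (V s) r) → All (Span b) b
  Span-∋ b = Allₚ.lookup⁻ (λ k → unitVec k , lc-unitVec k b)

  Supported : ∀ {r} → Subset r → Vec (Fin q) r → Set
  Supported A c = ∀ k → lookup A k ≡ false → lookup c k ≡ 0F

  supported? : ∀ {r} (A : Subset r) → Decidable (Supported A)
  supported? A c = Finₚ.all? (λ k → (lookup A k Boolₚ.≟ false) →-dec (lookup c k Finₚ.≟ 0F))

  SpanOn : ∀ {s r} → Subset r → Vec (V s) r → V s → Set
  SpanOn {r = r} A b u = Σ (Vec (Fin q) r) λ c → Supported A c × lc c b ≡ u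

  SpanOn-isSubspace : ∀ {s r} (A : Subset r) (b : Vec (V s) r) → IsSubspace (SpanOn A b)
  SpanOn-isSubspace A b = record
    { 0∈ = 𝟎 , (λ k _ → Vecₚ.lookup-replicate k 0F) , lc-𝟎 b
    ; +∈ = λ { (c , c∈A , refl) (c' , c'∈A , refl) →
               c ⊕ c' , (λ k k∉A → trans (Vecₚ.lookup-zipWith _+F_ k c c')
                                          (trans (cong₂ _+F_ (c∈A k k∉A) (c'∈A k k∉A)) (R.+-identityˡ 0F))) ,
               lc-⊕ c c' b }
    ; ·∈ = λ { a (c , c∈A , refl) →
               a ⊙ c , (λ k k∉A → trans (Vecₚ.lookup-map k (a *F_) c) (trans (cong (a *F_) (c∈A k k∉A)) (R.zeroʳ a))) ,
               lc-⊙ a c b } }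

  SpanOn-∋ : ∀ {s r} (A : Subset r) (b : Vec (V s) r) k → lookup A k ≡ true → SpanOn A b (lookup b k)
  SpanOn-∋ A b k k∈A = unitVec k , supported , lc-unitVec k b
    where
    supported : Supported A (unitVec k)
    supported k' k'∉A with k' Finₚ.≟ k
    ... | yes refl = case trans (sym k∈A) k'∉A of λ ()
    ... | no k'≢k  = lookup-unitVec k k' k'≢k

  lc-∈-supported : ∀ {s r} {W : V s → Set} → IsSubspace W → (A : Subset r) (c : Vec (Fin q) r) (b : Vec (V s) r) →
                   Supported A c → (∀ k → lookup A k ≡ true → W (lookup b k)) → W (lc c b)
  lc-∈-supported sub [] [] [] _ _ = 0∈ sub
  lc-∈-supported sub (true ∷ A) (x ∷ c) (u ∷ b) c∈A gens =
    +∈ sub (·∈ sub x (gens zero refl)) (lc-∈-supported sub A c b (c∈A ∘ suc) (gens ∘ suc))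
  lc-∈-supported {W = W} sub (false ∷ A) (x ∷ c) (u ∷ b) c∈A gens =
    subst W (cong (_⊕ lc c b) (trans (sym (⊙-zeroˡ u)) (cong (_⊙ u) (sym (c∈A zero refl)))))
      (subst W (sym (⊕-identityˡ _)) (lc-∈-supported sub A c b (c∈A ∘ suc) (gens ∘ suc)))

  SpanOn-least : ∀ {s r} {W : V s → Set} → IsSubspace W → (A : Subset r) (b : Vec (V s) r) →
                 (∀ k → lookup A k ≡ true → W (lookup b k)) → ∀ {u} → SpanOn A b u → W u
  SpanOn-least sub A b gens (c , c∈A , refl) = lc-∈-supported sub A c b c∈A gens

  Indep : ∀ {s r} → Vec (V s) r → Set
  Indep = LinIndep F

  indep-[] : ∀ {s} → Indep {s} []
  indep-[] [] _ = refl

  indep-∷⁻ : ∀ {s r} (u : V s) (b : Vec (V s) r) → Indep (u ∷ b) → Indep b × ¬ Span b u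
  indep-∷⁻ u b indep = tail-indep , u∉span
    where
    tail-indep : Indep b
    tail-indep c e = Vecₚ.∷-injectiveʳ (indep (0F ∷ c) (trans (cong₂ _⊕_ (⊙-zeroˡ u) e) (⊕-identityˡ 𝟎)))
    u∉span : ¬ Span b u
    u∉span (c , e) = -1≢0 (Vecₚ.∷-injectiveˡ (indep (-1F ∷ c) (trans (cong (-1F ⊙ u ⊕_) e) (⊕-inverseˡ u))))

  indep-∷⁺ : ∀ {s r} (u : V s) (b : Vec (V s) r) → Indep b → ¬ Span b u → Indep (u ∷ b)
  indep-∷⁺ u b indep u∉span (a ∷ c) e with a Finₚ.≟ 0F
  ... | yes refl = cong (0F ∷_) (indep c (trans (sym (⊕-identityˡ _)) (trans (cong (_⊕ lc c b) (sym (⊙-zeroˡ u))) e)))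
  ... | no a≢0   = ⊥-elim (u∉span ((a ⁻¹F *F -1F) ⊙ c , u≡lc))
    where
    open ≡-Reasoning
    au≡-lc : a ⊙ u ≡ -1F ⊙ lc c b
    au≡-lc = ⊕≡𝟎⇒≡-1⊙ (a ⊙ u) (lc c b) e
    u≡lc : lc ((a ⁻¹F *F -1F) ⊙ c) b ≡ u
    u≡lc = begin
      lc ((a ⁻¹F *F -1F) ⊙ c) b     ≡⟨ lc-⊙ _ c b ⟩
      (a ⁻¹F *F -1F) ⊙ lc c b       ≡⟨ ⊙-assoc _ _ _ ⟩
      a ⁻¹F ⊙ (-1F ⊙ lc c b)        ≡⟨ cong (a ⁻¹F ⊙_) (sym au≡-lc) ⟩
      a ⁻¹F ⊙ (a ⊙ u)               ≡⟨ sym (⊙-assoc _ _ _) ⟩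
      (a ⁻¹F *F a) ⊙ u              ≡⟨ cong (_⊙ u) (⁻¹-inverseˡ a a≢0) ⟩
      1F ⊙ u                        ≡⟨ ⊙-identityˡ u ⟩
      u                             ∎

  lc-injective : ∀ {s r} (b : Vec (V s) r) → Indep b → ∀ {c c'} → lc c b ≡ lc c' b → c ≡ c'
  lc-injective b indep {c} {c'} e = trans (⊕≡𝟎⇒≡-1⊙ c (-1F ⊙ c') c-c'≡𝟎) (-1⊙-involutive c')
    where
    c-c'≡𝟎 : c ⊕ -1F ⊙ c' ≡ 𝟎
    c-c'≡𝟎 = indep (c ⊕ -1F ⊙ c') (begin
      lc (c ⊕ -1F ⊙ c') b          ≡⟨ lc-⊕ c _ b ⟩
      lc c b ⊕ lc (-1F ⊙ c') b     ≡⟨ cong₂ _⊕_ e (lc-⊙ -1F c' b) ⟩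
      lc c' b ⊕ -1F ⊙ lc c' b      ≡⟨ ⊕-comm _ _ ⟩
      -1F ⊙ lc c' b ⊕ lc c' b      ≡⟨ ⊕-inverseˡ _ ⟩
      𝟎                            ∎)
      where open ≡-Reasoning

  enumV : ∀ s → Enumeration (V s)
  enumV = enumVec (enumFin q)

  countV : ∀ s {P : V s → Set} → Decidable P → ℕ
  countV s = count (enumV s)

  countV-all : ∀ s {P : V s → Set} (P? : Decidable P) → (∀ u → P u) → countV s P? ≡ q ^ s
  countV-all s P? all-P = trans (∑-cong (Enumeration.elements (enumV s)) (λ u → 𝟙-yes (all-P u) (P? u))) (size s)
    where
    size : ∀ s → ∑ (Enumeration.elements (enumV s)) (λ _ → 1) ≡ q ^ s
    size zero    = refl
    size (suc s) = begin
      ∑ (Enumeration.elements (enumV (suc s))) (λ _ → 1)                ≡⟨ ∑-pairs (enumFin q) (enumV s) _∷_ (λ _ → 1) ⟩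
      ∑ (allFin q) (λ _ → ∑ (Enumeration.elements (enumV s)) (λ _ → 1)) ≡⟨ ∑-cong (allFin q) (λ _ → size s) ⟩
      ∑ (allFin q) (λ _ → q ^ s)                                         ≡⟨ ∑-const (allFin q) (q ^ s) ⟩
      length (allFin q) * q ^ s                                          ≡⟨ cong (_* q ^ s) (Listₚ.length-tabulate {n = q} id) ⟩
      q ^ suc s                                                          ∎
      where open ≡-Reasoning

  count-Span : ∀ {s r} (b : Vec (V s) r) → Indep b → countV s (span? b) ≡ q ^ r
  count-Span {s} {r} b indep = begin
    countV s (span? b)                ≡⟨ CountAlongMaps.count-bijection (enumV r) (enumV s) (λ _ → yes tt) (span? b)
                                           (λ c → lc c b) (λ _ _ → lc-injective b indep) (λ {c} _ → c , refl)
                                           (λ (c , e) → c , tt , e) ⟩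
    countV r {λ _ → ⊤} (λ _ → yes tt) ≡⟨ countV-all r _ (λ _ → tt) ⟩
    q ^ r                             ∎
    where open ≡-Reasoning

  q≥2 : 2 ≤ q
  q≥2 = two-elements 0F 1F 0≢1
    where
    two-elements : ∀ {n} (a b : Fin n) → a ≢ b → 2 ≤ n
    two-elements {suc zero}    zero zero a≢b = ⊥-elim (a≢b refl)
    two-elements {suc (suc n)} _    _    _   = s≤s (s≤s z≤n)

  q^-injective : ∀ {a b} → q ^ a ≡ q ^ b → a ≡ b
  q^-injective {a} {b} e with <-cmp a b
  ... | tri< a<b _ _ = ⊥-elim (<-irrefl e (^-monoʳ-< q q≥2 a<b))
  ... | tri≈ _ a≡b _ = a≡b
  ... | tri> _ _ b<a = ⊥-elim (<-irrefl (sym e) (^-monoʳ-< q q≥2 b<a))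

  q^-cancel-≤ : ∀ {a b} → q ^ a ≤ q ^ b → a ≤ b
  q^-cancel-≤ {a} {b} le with a ≤? b
  ... | yes a≤b = a≤b
  ... | no a≰b  = ⊥-elim (<⇒≱ (^-monoʳ-< q q≥2 (≰⇒> a≰b)) le)

  module Dimension {s} {U : V s → Set} (U? : Decidable U) (U-sub : IsSubspace U) where

    private
      extend-to-basis : ∀ k {ℓ} → ℓ + k ≡ s → (b : Vec (V s) ℓ) → Indep b → All U b → Σ ℕ (HasDim F s U U?)
      extend-to-basis zero {ℓ} ℓ+0≡s b indep b∈U = ℓ , b , b∈U , indep , λ u _ → spans-everything u tt
        where
        spans-everything : ∀ u → ⊤ → Span b u
        spans-everything = count-≤⇒⊇ (enumV s) (span? b) (λ _ → yes tt) (λ _ _ → tt) (≤-reflexive (begin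
          countV s {λ _ → ⊤} (λ _ → yes tt) ≡⟨ countV-all s _ (λ _ → tt) ⟩
          q ^ s                             ≡⟨ cong (q ^_) (trans (sym ℓ+0≡s) (+-identityʳ ℓ)) ⟩
          q ^ ℓ                             ≡⟨ sym (count-Span b indep) ⟩
          countV s (span? b)                ∎))
          where open ≡-Reasoning
      extend-to-basis (suc k) {ℓ} ℓ+k≡s b indep b∈U with ∃V? F s (λ u → U? u ×-dec ¬? (span? b u))
      ... | yes (u , u∈U , u∉b) =
        extend-to-basis k (trans (sym (+-suc ℓ k)) ℓ+k≡s) (u ∷ b) (indep-∷⁺ u b indep u∉b) (u∈U ∷ b∈U)
      ... | no none = ℓ , b , b∈U , indep , λ u u∈U → decidable-stable (span? b u) (λ u∉b → none (u , u∈U , u∉b))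

    basis : Σ ℕ (HasDim F s U U?)
    basis = extend-to-basis s refl [] indep-[] []

    HasDim⇒count : ∀ {r} → HasDim F s U U? r → countV s U? ≡ q ^ r
    HasDim⇒count (b , b∈U , indep , spans) =
      trans (count-cong (enumV s) U? (span? b) spans (λ { u (c , refl) → lc-∈ U-sub c b b∈U })) (count-Span b indep)

    count⇒HasDim : ∀ {r} → countV s U? ≡ q ^ r → HasDim F s U U? r
    count⇒HasDim |U|≡q^r =
      subst (HasDim F s U U?) (q^-injective (trans (sym (HasDim⇒count (proj₂ basis))) |U|≡q^r)) (proj₂ basis)

    dimension : Σ ℕ (λ m → m ≤ s × countV s U? ≡ q ^ m)
    dimension = proj₁ basis , q^-cancel-≤ |U|≤q^s , HasDim⇒count (proj₂ basis)
      where
      |U|≤q^s : q ^ proj₁ basis ≤ q ^ s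
      |U|≤q^s = subst₂ _≤_ (HasDim⇒count (proj₂ basis)) (countV-all s _ (λ _ → tt))
                           (count-mono (enumV s) U? (λ _ → yes tt) (λ _ _ → tt))

  module IndependentTuples {s} {W : V s → Set} (W? : Decidable W) (W-sub : IsSubspace W)
                           {m} (|W|≡q^m : countV s W? ≡ q ^ m) where

    IndepIn : ∀ {ℓ} → Vec (V s) ℓ → Set
    IndepIn b = Indep b × All W b

    indepIn? : ∀ {ℓ} → Decidable (IndepIn {ℓ})
    indepIn? b = linIndep? F b ×-dec All.all? W? b

    count-outside-Span : ∀ {ℓ} (b : Vec (V s) ℓ) → IndepIn b →
                         countV s (λ u → W? u ×-dec ¬? (span? b u)) ≡ q ^ m ∸ q ^ ℓ
    count-outside-Span {ℓ} b (indep , b∈W) = begin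
      countV s (λ u → W? u ×-dec ¬? (span? b u))
        ≡⟨ sym (m+n∸m≡n (q ^ ℓ) _) ⟩
      q ^ ℓ + countV s (λ u → W? u ×-dec ¬? (span? b u)) ∸ q ^ ℓ
        ≡⟨ cong (λ x → x + countV s (λ u → W? u ×-dec ¬? (span? b u)) ∸ q ^ ℓ) (sym |W∩Span|) ⟩
      countV s (λ u → W? u ×-dec span? b u) + countV s (λ u → W? u ×-dec ¬? (span? b u)) ∸ q ^ ℓ
        ≡⟨ cong (_∸ q ^ ℓ) (sym (count-split (enumV s) W? (span? b))) ⟩
      countV s W? ∸ q ^ ℓ
        ≡⟨ cong (_∸ q ^ ℓ) |W|≡q^m ⟩
      q ^ m ∸ q ^ ℓ ∎
      where
      open ≡-Reasoning
      |W∩Span| : countV s (λ u → W? u ×-dec span? b u) ≡ q ^ ℓ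
      |W∩Span| = trans (count-cong (enumV s) _ (span? b) (λ _ → proj₂) (λ { u (c , refl) → lc-∈ W-sub c b b∈W , (c , refl) }))
                       (count-Span b indep)

    count-IndepIn : ∀ ℓ → count (enumVec (enumV s) ℓ) indepIn? ≡ prodℕ ℓ (λ j → q ^ m ∸ q ^ j)
    count-IndepIn zero    = trans (+-identityʳ _) (𝟙-yes (indep-[] , []) (indepIn? []))
    count-IndepIn (suc ℓ) = begin
      ∑ (Enumeration.elements (enumVec (enumV s) (suc ℓ))) (λ b → 𝟙 (indepIn? b))
        ≡⟨ ∑-pairs (enumV s) (enumVec (enumV s) ℓ) _∷_ _ ⟩
      ∑ us (λ u → ∑ bs (λ b → 𝟙 (indepIn? (u ∷ b))))
        ≡⟨ ∑-cong us (λ u → ∑-cong bs (λ b → 𝟙-indepIn-∷ u b)) ⟩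
      ∑ us (λ u → ∑ bs (λ b → 𝟙 (indepIn? b) * 𝟙 (W? u ×-dec ¬? (span? b u))))
        ≡⟨ ∑-comm us bs _ ⟩
      ∑ bs (λ b → ∑ us (λ u → 𝟙 (indepIn? b) * 𝟙 (W? u ×-dec ¬? (span? b u))))
        ≡⟨ ∑-cong bs (λ b → ∑-*ˡ us (𝟙 (indepIn? b)) _) ⟩
      ∑ bs (λ b → 𝟙 (indepIn? b) * countV s (λ u → W? u ×-dec ¬? (span? b u)))
        ≡⟨ ∑-cong bs (λ b → 𝟙-*-cong (indepIn? b) (count-outside-Span b)) ⟩
      ∑ bs (λ b → 𝟙 (indepIn? b) * (q ^ m ∸ q ^ ℓ))
        ≡⟨ ∑-*ʳ bs _ _ ⟩
      count (enumVec (enumV s) ℓ) indepIn? * (q ^ m ∸ q ^ ℓ)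
        ≡⟨ cong (_* (q ^ m ∸ q ^ ℓ)) (count-IndepIn ℓ) ⟩
      prodℕ (suc ℓ) (λ j → q ^ m ∸ q ^ j) ∎
      where
      open ≡-Reasoning
      us : List (V s)
      us = Enumeration.elements (enumV s)
      bs : List (Vec (V s) ℓ)
      bs = Enumeration.elements (enumVec (enumV s) ℓ)
      𝟙-indepIn-∷ : ∀ u b → 𝟙 (indepIn? (u ∷ b)) ≡ 𝟙 (indepIn? b) * 𝟙 (W? u ×-dec ¬? (span? b u))
      𝟙-indepIn-∷ u b = trans
        (𝟙-cong (λ { (indep , u∈W ∷ b∈W) → (proj₁ (indep-∷⁻ u b indep) , b∈W) , u∈W , proj₂ (indep-∷⁻ u b indep) })
                (λ ((indep , b∈W) , u∈W , u∉b) → indep-∷⁺ u b indep u∉b , u∈W ∷ b∈W)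
                (indepIn? (u ∷ b)) (indepIn? b ×-dec (W? u ×-dec ¬? (span? b u))))
        (𝟙-× (indepIn? b) _)

module Projective {q : ℕ} (F : FiniteField q) where
  open Counting
  open Subsets
  open LinearAlgebra F
  open FiniteField F

  normalize : ∀ {s} → V s → V s
  normalize []      = []
  normalize (x ∷ v) with x Finₚ.≟ 0F
  ... | yes _ = 0F ∷ normalize v
  ... | no _  = 1F ∷ x ⁻¹F ⊙ v

  leadingCoeff : ∀ {s} → V s → Fin q
  leadingCoeff []      = 1F
  leadingCoeff (x ∷ v) with x Finₚ.≟ 0F
  ... | yes _ = leadingCoeff v
  ... | no _  = x

  leadingCoeff≢0 : ∀ {s} (v : V s) → leadingCoeff v ≢ 0F
  leadingCoeff≢0 []      = 1≢0
  leadingCoeff≢0 (x ∷ v) with x Finₚ.≟ 0F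
  ... | yes _   = leadingCoeff≢0 v
  ... | no x≢0  = x≢0

  leadingCoeff-⊙-normalize : ∀ {s} (v : V s) → leadingCoeff v ⊙ normalize v ≡ v
  leadingCoeff-⊙-normalize []      = refl
  leadingCoeff-⊙-normalize (x ∷ v) with x Finₚ.≟ 0F
  ... | yes refl = cong₂ _∷_ (R.zeroʳ (leadingCoeff v)) (leadingCoeff-⊙-normalize v)
  ... | no x≢0   = cong₂ _∷_ (R.*-identityʳ x)
                     (trans (sym (⊙-assoc x (x ⁻¹F) v)) (trans (cong (_⊙ v) (⁻¹-inverse x x≢0)) (⊙-identityˡ v)))

  normalize≡⁻¹⊙ : ∀ {s} (v : V s) → normalize v ≡ leadingCoeff v ⁻¹F ⊙ v
  normalize≡⁻¹⊙ v = begin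
    normalize v                                           ≡⟨ sym (⊙-identityˡ _) ⟩
    1F ⊙ normalize v                                      ≡⟨ cong (_⊙ normalize v) (sym (⁻¹-inverseˡ _ (leadingCoeff≢0 v))) ⟩
    (leadingCoeff v ⁻¹F *F leadingCoeff v) ⊙ normalize v  ≡⟨ ⊙-assoc _ _ _ ⟩
    leadingCoeff v ⁻¹F ⊙ (leadingCoeff v ⊙ normalize v)   ≡⟨ cong (leadingCoeff v ⁻¹F ⊙_) (leadingCoeff-⊙-normalize v) ⟩
    leadingCoeff v ⁻¹F ⊙ v                                ∎
    where open ≡-Reasoning

  Normalized⇒≢𝟎 : ∀ {s} (v : V s) → Normalized F v → v ≢ 𝟎
  Normalized⇒≢𝟎 (x ∷ v) (inj₁ x≡1)      e = 1≢0 (trans (sym x≡1) (Vecₚ.∷-injectiveˡ e))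
  Normalized⇒≢𝟎 (x ∷ v) (inj₂ (_ , nv)) e = Normalized⇒≢𝟎 v nv (Vecₚ.∷-injectiveʳ e)

  normalize-Normalized : ∀ {s} (v : V s) → v ≢ 𝟎 → Normalized F (normalize v)
  normalize-Normalized []      v≢𝟎 = v≢𝟎 refl
  normalize-Normalized (x ∷ v) v≢𝟎 with x Finₚ.≟ 0F
  ... | yes refl = inj₂ (refl , normalize-Normalized v (v≢𝟎 ∘ cong (0F ∷_)))
  ... | no _     = inj₁ refl

  normalize-Normalized-id : ∀ {s} (v : V s) → Normalized F v → normalize v ≡ v
  normalize-Normalized-id (x ∷ v) nv with x Finₚ.≟ 0F
  normalize-Normalized-id (x ∷ v) (inj₁ x≡1)         | yes x≡0 = ⊥-elim (1≢0 (trans (sym x≡1) x≡0))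
  normalize-Normalized-id (x ∷ v) (inj₂ (_ , nv))    | yes refl = cong (0F ∷_) (normalize-Normalized-id v nv)
  normalize-Normalized-id (x ∷ v) (inj₁ refl)        | no _    = cong (1F ∷_) (trans (cong (_⊙ v) 1⁻¹≡1) (⊙-identityˡ v))
    where
    1⁻¹≡1 : 1F ⁻¹F ≡ 1F
    1⁻¹≡1 = trans (sym (R.*-identityˡ (1F ⁻¹F))) (⁻¹-inverse 1F 1≢0)
  normalize-Normalized-id (x ∷ v) (inj₂ (refl , _))  | no x≢0  = ⊥-elim (x≢0 refl)

  normalize-⊙ : ∀ {s} a (v : V s) → a ≢ 0F → normalize (a ⊙ v) ≡ normalize v
  normalize-⊙ a []      a≢0 = refl
  normalize-⊙ a (x ∷ v) a≢0 with x Finₚ.≟ 0F | (a *F x) Finₚ.≟ 0F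
  ... | yes _    | yes _    = cong (0F ∷_) (normalize-⊙ a v a≢0)
  ... | yes refl | no ax≢0  = ⊥-elim (ax≢0 (R.zeroʳ a))
  ... | no x≢0   | yes ax≡0 = ⊥-elim (*-nonzero a≢0 x≢0 ax≡0)
  ... | no x≢0   | no _     = cong (1F ∷_) (trans (sym (⊙-assoc _ a v)) (cong (_⊙ v) [ax]⁻¹a≡x⁻¹))
    where
    [ax]⁻¹a≡x⁻¹ : (a *F x) ⁻¹F *F a ≡ x ⁻¹F
    [ax]⁻¹a≡x⁻¹ = begin
      (a *F x) ⁻¹F *F a                         ≡⟨ sym (R.*-identityʳ _) ⟩
      ((a *F x) ⁻¹F *F a) *F 1F                 ≡⟨ cong (((a *F x) ⁻¹F *F a) *F_) (sym (⁻¹-inverse x x≢0)) ⟩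
      ((a *F x) ⁻¹F *F a) *F (x *F x ⁻¹F)       ≡⟨ sym (R.*-assoc _ x _) ⟩
      (((a *F x) ⁻¹F *F a) *F x) *F x ⁻¹F       ≡⟨ cong (_*F x ⁻¹F) (R.*-assoc _ a x) ⟩
      ((a *F x) ⁻¹F *F (a *F x)) *F x ⁻¹F       ≡⟨ cong (_*F x ⁻¹F) (⁻¹-inverseˡ _ (*-nonzero a≢0 x≢0)) ⟩
      1F *F x ⁻¹F                               ≡⟨ R.*-identityˡ _ ⟩
      x ⁻¹F                                     ∎
      where open ≡-Reasoning

  normalize-≡⇒proportional : ∀ {s} (v w : V s) → normalize v ≡ normalize w →
                             v ≡ (leadingCoeff v *F leadingCoeff w ⁻¹F) ⊙ w
  normalize-≡⇒proportional v w e = begin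
    v                                               ≡⟨ sym (leadingCoeff-⊙-normalize v) ⟩
    leadingCoeff v ⊙ normalize v                    ≡⟨ cong (leadingCoeff v ⊙_) (trans e (normalize≡⁻¹⊙ w)) ⟩
    leadingCoeff v ⊙ (leadingCoeff w ⁻¹F ⊙ w)       ≡⟨ sym (⊙-assoc _ _ w) ⟩
    (leadingCoeff v *F leadingCoeff w ⁻¹F) ⊙ w      ∎
    where open ≡-Reasoning

  #ℙ : ℕ → ℕ
  #ℙ = |ℙ| F

  pt : ∀ s → Fin (#ℙ s) → V s
  pt = point F

  private
    vecs : ∀ s → List (V s)
    vecs s = Enumeration.elements (enumV s)

    allVecs≡vecs : ∀ s → allVecs F s ≡ vecs s
    allVecs≡vecs zero    = refl
    allVecs≡vecs (suc s) = cong (λ vs → concatMap (λ a → List.map (a ∷_) vs) (allFin q)) (allVecs≡vecs s)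

  ∑-points : ∀ s (f : V s → ℕ) → ∑ (points F s) f ≡ ∑ (vecs s) (λ v → 𝟙 (normalized? F v) * f v)
  ∑-points s f = trans (∑-filter (normalized? F) (allVecs F s) f)
                       (cong (λ vs → ∑ vs (λ v → 𝟙 (normalized? F v) * f v)) (allVecs≡vecs s))

  occurrences-in-points : ∀ s (v : V s) → ∑ (points F s) (λ y → 𝟙 (_≟V_ F y v)) ≡ 𝟙 (normalized? F v)
  occurrences-in-points s v = trans (∑-points s _) (trans (∑-cong (vecs s) swap) (∑-select (enumV s) v _))
    where
    swap : ∀ y → 𝟙 (normalized? F y) * 𝟙 (_≟V_ F y v) ≡ 𝟙 (Enumeration.decEq (enumV s) y v) * 𝟙 (normalized? F v)
    swap y with _≟V_ F y v | Enumeration.decEq (enumV s) y v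
    ... | yes refl | yes _    = *-comm _ 1
    ... | yes refl | no y≢y   = ⊥-elim (y≢y refl)
    ... | no y≢y   | yes refl = ⊥-elim (y≢y refl)
    ... | no _     | no _     = *-zeroʳ (𝟙 (normalized? F y))

  point-Normalized : ∀ s k → Normalized F (pt s k)
  point-Normalized s k = decidable-stable (normalized? F (pt s k)) λ ¬normalized → 1≰0 (begin
    1                                                     ≡⟨ sym (𝟙-yes refl (_≟V_ F (pt s k) (pt s k))) ⟩
    𝟙 (_≟V_ F (pt s k) (pt s k))                          ≤⟨ ∑-lookup-≤ (points F s) (λ y → 𝟙 (_≟V_ F y (pt s k))) k ⟩
    ∑ (points F s) (λ y → 𝟙 (_≟V_ F y (pt s k)))          ≡⟨ occurrences-in-points s (pt s k) ⟩
    𝟙 (normalized? F (pt s k))                            ≡⟨ 𝟙-no ¬normalized (normalized? F (pt s k)) ⟩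
    0                                                     ∎)
    where
    open ≤-Reasoning
    1≰0 : ¬ (1 ≤ 0)
    1≰0 ()

  point-injective : ∀ s {k k'} → pt s k ≡ pt s k' → k ≡ k'
  point-injective s {k} {k'} e with k Finₚ.≟ k'
  ... | yes k≡k' = k≡k'
  ... | no k≢k'  = ⊥-elim (2≰1 (begin
    2                                                     ≡⟨ sym (cong₂ _+_ (𝟙-yes e (_≟V_ F (pt s k) v)) (𝟙-yes refl (_≟V_ F v v))) ⟩
    𝟙 (_≟V_ F (pt s k) v) + 𝟙 (_≟V_ F v v)                ≤⟨ ∑-lookup₂-≤ (points F s) (λ y → 𝟙 (_≟V_ F y v)) k k' k≢k' ⟩
    ∑ (points F s) (λ y → 𝟙 (_≟V_ F y v))                 ≡⟨ occurrences-in-points s v ⟩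
    𝟙 (normalized? F v)                                   ≤⟨ 𝟙≤1 (normalized? F v) ⟩
    1                                                     ∎))
    where
    open ≤-Reasoning
    v : V s
    v = pt s k'
    2≰1 : ¬ (2 ≤ 1)
    2≰1 (s≤s ())

  point-surjective : ∀ s (v : V s) → Normalized F v → Σ (Fin (#ℙ s)) (λ k → pt s k ≡ v)
  point-surjective s v nv with Finₚ.any? (λ k → _≟V_ F (pt s k) v)
  ... | yes found = found
  ... | no ¬found = ⊥-elim (0≢1+n (begin
    0                                                     ≡⟨ sym (∑-zero (allFin (#ℙ s))) ⟩
    ∑ (allFin (#ℙ s)) (λ _ → 0)                           ≡⟨ ∑-cong (allFin (#ℙ s)) (λ k → sym (𝟙-no (¬found ∘ (k ,_)) (_≟V_ F (pt s k) v))) ⟩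
    ∑ (allFin (#ℙ s)) (λ k → 𝟙 (_≟V_ F (pt s k) v))       ≡⟨ sym (∑-lookup (points F s) (λ y → 𝟙 (_≟V_ F y v))) ⟩
    ∑ (points F s) (λ y → 𝟙 (_≟V_ F y v))                 ≡⟨ occurrences-in-points s v ⟩
    𝟙 (normalized? F v)                                   ≡⟨ 𝟙-yes nv (normalized? F v) ⟩
    1                                                     ∎))
    where open ≡-Reasoning

  count-Normalized : ∀ s → countV s (normalized? F) ≡ ⟨ s ⟩[ q ]
  count-Normalized zero    = refl
  count-Normalized (suc s) = begin
    countV (suc s) (normalized? F)
      ≡⟨ ∑-pairs (enumFin q) (enumV s) _∷_ _ ⟩
    ∑ (allFin q) (λ a → ∑ (vecs s) (λ v → 𝟙 (normalized? F (a ∷ v))))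
      ≡⟨ ∑-cong (allFin q) by-head ⟩
    ∑ (allFin q) (λ a → 𝟙 (a Finₚ.≟ 1F) * q ^ s + 𝟙 (a Finₚ.≟ 0F) * countV s (normalized? F))
      ≡⟨ ∑-distrib-+ (allFin q) _ _ ⟩
    ∑ (allFin q) (λ a → 𝟙 (a Finₚ.≟ 1F) * q ^ s) + ∑ (allFin q) (λ a → 𝟙 (a Finₚ.≟ 0F) * countV s (normalized? F))
      ≡⟨ cong₂ _+_ (∑-select (enumFin q) 1F _) (∑-select (enumFin q) 0F _) ⟩
    q ^ s + countV s (normalized? F)
      ≡⟨ +-comm (q ^ s) _ ⟩
    countV s (normalized? F) + q ^ s
      ≡⟨ cong (_+ q ^ s) (count-Normalized s) ⟩
    ⟨ suc s ⟩[ q ] ∎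
    where
    open ≡-Reasoning
    by-head : ∀ a → ∑ (vecs s) (λ v → 𝟙 (normalized? F (a ∷ v))) ≡
                    𝟙 (a Finₚ.≟ 1F) * q ^ s + 𝟙 (a Finₚ.≟ 0F) * countV s (normalized? F)
    by-head a with a Finₚ.≟ 1F | a Finₚ.≟ 0F
    ... | yes refl | yes 1≡0 = ⊥-elim (1≢0 1≡0)
    ... | yes refl | no _    = trans (countV-all s (λ _ → yes tt) (λ _ → tt)) (sym (trans (+-identityʳ (1 * q ^ s)) (*-identityˡ (q ^ s))))
    ... | no a≢1   | yes refl = trans (∑-cong (vecs s) (λ v → 𝟙-cong (λ { (inj₁ 0≡1) → ⊥-elim (0≢1 0≡1) ; (inj₂ (_ , nv)) → nv })
                                                               (λ nv → inj₂ (refl , nv)) _ (normalized? F v)))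
                                    (sym (+-identityʳ _))
    ... | no a≢1   | no a≢0  = count-none (enumV s) (λ v → no a≢1 ⊎-dec (no a≢0 ×-dec normalized? F v))
                                   (λ v → λ { (inj₁ a≡1) → a≢1 a≡1 ; (inj₂ (a≡0 , _)) → a≢0 a≡0 })

  #ℙ≡⟨⟩ : ∀ s → #ℙ s ≡ ⟨ s ⟩[ q ]
  #ℙ≡⟨⟩ s = begin
    #ℙ s                                          ≡⟨ sym (*-identityʳ _) ⟩
    #ℙ s * 1                                      ≡⟨ sym (∑-const (points F s) 1) ⟩
    ∑ (points F s) (λ _ → 1)                      ≡⟨ ∑-points s (λ _ → 1) ⟩
    ∑ (vecs s) (λ v → 𝟙 (normalized? F v) * 1)    ≡⟨ ∑-cong (vecs s) (λ _ → *-identityʳ _) ⟩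
    countV s (normalized? F)                      ≡⟨ count-Normalized s ⟩
    ⟨ s ⟩[ q ]                                    ∎
    where open ≡-Reasoning

  InSpan-isSubspace : ∀ s A → IsSubspace (InSpan F s A)
  InSpan-isSubspace s A = SpanOn-isSubspace A (tabulate (pt s))

  InSpan-∋ : ∀ s A k → lookup A k ≡ true → InSpan F s A (pt s k)
  InSpan-∋ s A k k∈A = subst (InSpan F s A) (Vecₚ.lookup∘tabulate (pt s) k) (SpanOn-∋ A (tabulate (pt s)) k k∈A)

  InSpan-least : ∀ s A {W : V s → Set} → IsSubspace W → (∀ k → lookup A k ≡ true → W (pt s k)) →
                 ∀ {u} → InSpan F s A u → W u
  InSpan-least s A {W} W-sub gens =
    SpanOn-least W-sub A (tabulate (pt s)) (λ k k∈A → subst W (sym (Vecₚ.lookup∘tabulate (pt s) k)) (gens k k∈A))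

  InSpan-mono : ∀ s (A B : Subset (#ℙ s)) → (∀ k → lookup A k ≡ true → lookup B k ≡ true) →
                ∀ {u} → InSpan F s A u → InSpan F s B u
  InSpan-mono s A B A⊆B = InSpan-least s A (InSpan-isSubspace s B) (λ k k∈A → InSpan-∋ s B k (A⊆B k k∈A))

  count-Supported : ∀ {r} (A : Subset r) → countV r (supported? A) ≡ q ^ ∣ A ∣
  count-Supported []               = refl
  count-Supported {suc r} (x ∷ A)  = begin
    countV (suc r) (supported? (x ∷ A))
      ≡⟨ ∑-pairs (enumFin q) (enumV r) _∷_ _ ⟩
    ∑ (allFin q) (λ a → ∑ cs (λ c → 𝟙 (supported? (x ∷ A) (a ∷ c))))
      ≡⟨ ∑-cong (allFin q) (λ a → ∑-cong cs (λ c → 𝟙-supported-∷ a c)) ⟩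
    ∑ (allFin q) (λ a → ∑ cs (λ c → 𝟙 (head? a) * 𝟙 (supported? A c)))
      ≡⟨ ∑-cong (allFin q) (λ a → ∑-*ˡ cs (𝟙 (head? a)) _) ⟩
    ∑ (allFin q) (λ a → 𝟙 (head? a) * countV r (supported? A))
      ≡⟨ ∑-*ʳ (allFin q) _ _ ⟩
    ∑ (allFin q) (λ a → 𝟙 (head? a)) * countV r (supported? A)
      ≡⟨ cong₂ _*_ (count-head x) (count-Supported A) ⟩
    (if x then q else 1) * q ^ ∣ A ∣
      ≡⟨ pow x ⟩
    q ^ ∣ x ∷ A ∣ ∎
    where
    open ≡-Reasoning
    cs : List (V r)
    cs = Enumeration.elements (enumV r)
    head? : ∀ a → Dec (x ≡ false → a ≡ 0F)
    head? a = (x Boolₚ.≟ false) →-dec (a Finₚ.≟ 0F)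
    𝟙-supported-∷ : ∀ a c → 𝟙 (supported? (x ∷ A) (a ∷ c)) ≡ 𝟙 (head? a) * 𝟙 (supported? A c)
    𝟙-supported-∷ a c = trans
      (𝟙-cong (λ sup → sup zero , sup ∘ suc) (λ { (sup₀ , sup) zero → sup₀ ; (sup₀ , sup) (suc k) → sup k })
              (supported? (x ∷ A) (a ∷ c)) (head? a ×-dec supported? A c))
      (𝟙-× (head? a) (supported? A c))
    count-head : ∀ x → count (enumFin q) (λ a → (x Boolₚ.≟ false) →-dec (a Finₚ.≟ 0F)) ≡ (if x then q else 1)
    count-head true  = trans (count-all (enumFin q) (λ a → (true Boolₚ.≟ false) →-dec (a Finₚ.≟ 0F)) (λ _ ()))
                             (Listₚ.length-tabulate id)
    count-head false = trans (count-cong (enumFin q) _ (λ a → a Finₚ.≟ 0F) (λ _ f → f refl) (λ _ e _ → e))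
                             (Enumeration.once (enumFin q) 0F)
    pow : ∀ x → (if x then q else 1) * q ^ ∣ A ∣ ≡ q ^ ∣ x ∷ A ∣
    pow true  = refl
    pow false = *-identityˡ _

  count-InSpan-≤ : ∀ s A → countV s (inSpan? F s A) ≤ q ^ ∣ A ∣
  count-InSpan-≤ s A = subst (countV s (inSpan? F s A) ≤_) (count-Supported A)
    (CountAlongMaps.count-≤-surjection (enumV (#ℙ s)) (enumV s) (supported? A) (inSpan? F s A)
       (λ c → lc c (tabulate (pt s))) (λ (c , c∈A , e) → c , c∈A , e))

  InSpanWith : ∀ s → Subset (#ℙ s) → Fin (#ℙ s) → V s → Set
  InSpanWith s A k u = Σ (Fin q) λ a → Σ (V s) λ x → InSpan F s A x × x ⊕ a ⊙ pt s k ≡ u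

  InSpanWith-isSubspace : ∀ s A k → IsSubspace (InSpanWith s A k)
  InSpanWith-isSubspace s A k = record
    { 0∈ = 0F , 𝟎 , 0∈ ⟨A⟩ , trans (cong (𝟎 ⊕_) (⊙-zeroˡ p)) (⊕-identityˡ 𝟎)
    ; +∈ = λ { (a , x , x∈A , refl) (a' , x' , x'∈A , refl) →
               a +F a' , x ⊕ x' , +∈ ⟨A⟩ x∈A x'∈A ,
               trans (cong (x ⊕ x' ⊕_) (⊙-distribʳ-+ a a' p)) (sym (⊕-interchange x (a ⊙ p) x' (a' ⊙ p))) }
    ; ·∈ = λ { c (a , x , x∈A , refl) →
               c *F a , c ⊙ x , ·∈ ⟨A⟩ c x∈A ,
               trans (cong (c ⊙ x ⊕_) (⊙-assoc c a p)) (sym (⊙-distribˡ-⊕ c x (a ⊙ p))) } }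
    where
    p : V s
    p = pt s k
    ⟨A⟩ : IsSubspace (InSpan F s A)
    ⟨A⟩ = InSpan-isSubspace s A

  InSpan-[]≔true⇒InSpanWith : ∀ s A k {u} → InSpan F s (A [ k ]≔ true) u → InSpanWith s A k u
  InSpan-[]≔true⇒InSpanWith s A k = InSpan-least s (A [ k ]≔ true) (InSpanWith-isSubspace s A k) gens
    where
    gens : ∀ k' → lookup (A [ k ]≔ true) k' ≡ true → InSpanWith s A k (pt s k')
    gens k' k'∈A+k with k' Finₚ.≟ k
    ... | yes refl = 1F , 𝟎 , 0∈ (InSpan-isSubspace s A) , trans (cong (𝟎 ⊕_) (⊙-identityˡ _)) (⊕-identityˡ _)
    ... | no k'≢k  = 0F , pt s k' , InSpan-∋ s A k' (trans (sym (Vecₚ.lookup∘update′ k'≢k A true)) k'∈A+k) ,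
                     trans (cong (pt s k' ⊕_) (⊙-zeroˡ _)) (⊕-identityʳ _)

  ext-Bool : ∀ {x y : Bool} → (x ≡ true → y ≡ true) → (y ≡ true → x ≡ true) → x ≡ y
  ext-Bool {true}  {true}  _ _ = refl
  ext-Bool {true}  {false} f _ = sym (f refl)
  ext-Bool {false} {true}  _ g = g refl
  ext-Bool {false} {false} _ _ = refl

  Vec-ext : ∀ {A : Set} {m} {u v : Vec A m} → (∀ k → lookup u k ≡ lookup v k) → u ≡ v
  Vec-ext {u = u} {v} e = trans (sym (Vecₚ.tabulate∘lookup u)) (trans (Vecₚ.tabulate-cong e) (Vecₚ.tabulate∘lookup v))

  SpansSpan : ∀ {n r} → Vec (V n) r → Subset (#ℙ n) → Set
  SpansSpan {n} b B = ∀ u → (InSpan F n B u → Span b u) × (Span b u → InSpan F n B u)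

  spansSpan? : ∀ {n r} (b : Vec (V n) r) → Decidable (SpansSpan b)
  spansSpan? {n} b B = ∀V? F n (λ u → (inSpan? F n B u →-dec span? b u) ×-dec (span? b u →-dec inSpan? F n B u))

  module Transport {n r} (b : Vec (V n) r) (indep : Indep b) where

    φ : V r → V n
    φ c = lc c b

    private
      φ-pt≢𝟎 : ∀ k → φ (pt r k) ≢ 𝟎
      φ-pt≢𝟎 k e = Normalized⇒≢𝟎 _ (point-Normalized r k) (lc-injective b indep (trans e (sym (lc-𝟎 b))))

      image-point : ∀ k → Σ (Fin (#ℙ n)) (λ k' → pt n k' ≡ normalize (φ (pt r k)))
      image-point k = point-surjective n _ (normalize-Normalized _ (φ-pt≢𝟎 k))

      λ⁻¹ : Fin (#ℙ r) → Fin q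
      λ⁻¹ k = leadingCoeff (φ (pt r k)) ⁻¹F

    image : Fin (#ℙ r) → Fin (#ℙ n)
    image k = proj₁ (image-point k)

    pt-image : ∀ k → pt n (image k) ≡ normalize (φ (pt r k))
    pt-image k = proj₂ (image-point k)

    pt-image≡φ : ∀ k → pt n (image k) ≡ φ (λ⁻¹ k ⊙ pt r k)
    pt-image≡φ k = trans (pt-image k) (trans (normalize≡⁻¹⊙ _) (sym (lc-⊙ _ (pt r k) b)))

    φ-pt≡⊙pt-image : ∀ k → φ (pt r k) ≡ leadingCoeff (φ (pt r k)) ⊙ pt n (image k)
    φ-pt≡⊙pt-image k = trans (sym (leadingCoeff-⊙-normalize _)) (cong (_ ⊙_) (sym (pt-image k)))

    image-injective : ∀ {k k'} → image k ≡ image k' → k ≡ k'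
    image-injective {k} {k'} e = point-injective r (begin
      p                           ≡⟨ sym (normalize-Normalized-id _ (point-Normalized r k)) ⟩
      normalize p                 ≡⟨ cong normalize p≡cp' ⟩
      normalize (c ⊙ p')          ≡⟨ normalize-⊙ c p' c≢0 ⟩
      normalize p'                ≡⟨ normalize-Normalized-id _ (point-Normalized r k') ⟩
      p'                          ∎)
      where
      open ≡-Reasoning
      p p' : V r
      p = pt r k
      p' = pt r k'
      c : Fin q
      c = leadingCoeff (φ p) *F leadingCoeff (φ p') ⁻¹F
      c≢0 : c ≢ 0F
      c≢0 = *-nonzero (leadingCoeff≢0 (φ p)) (⁻¹-nonzero (leadingCoeff≢0 (φ p')))
      p≡cp' : p ≡ c ⊙ p'
      p≡cp' = lc-injective b indep (trans
        (normalize-≡⇒proportional (φ p) (φ p') (trans (sym (pt-image k)) (trans (cong (pt n) e) (pt-image k'))))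
        (sym (lc-⊙ c p' b)))

    image-onto-Span : ∀ k → Span b (pt n k) → Σ (Fin (#ℙ r)) (λ k' → image k' ≡ k)
    image-onto-Span k (c , φc≡pt) = k' , point-injective n (begin
      pt n (image k')                     ≡⟨ pt-image k' ⟩
      normalize (φ (pt r k'))             ≡⟨ cong (normalize ∘ φ) (trans pt-k'≡ (normalize≡⁻¹⊙ c)) ⟩
      normalize (φ (leadingCoeff c ⁻¹F ⊙ c)) ≡⟨ cong normalize (lc-⊙ _ c b) ⟩
      normalize (leadingCoeff c ⁻¹F ⊙ φ c)   ≡⟨ normalize-⊙ _ (φ c) (⁻¹-nonzero (leadingCoeff≢0 c)) ⟩
      normalize (φ c)                     ≡⟨ cong normalize φc≡pt ⟩
      normalize (pt n k)                  ≡⟨ normalize-Normalized-id _ (point-Normalized n k) ⟩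
      pt n k                              ∎)
      where
      open ≡-Reasoning
      c≢𝟎 : c ≢ 𝟎
      c≢𝟎 c≡𝟎 = Normalized⇒≢𝟎 _ (point-Normalized n k) (trans (sym φc≡pt) (trans (cong φ c≡𝟎) (lc-𝟎 b)))
      k' : Fin (#ℙ r)
      k' = proj₁ (point-surjective r (normalize c) (normalize-Normalized c c≢𝟎))
      pt-k'≡ : pt r k' ≡ normalize c
      pt-k'≡ = proj₂ (point-surjective r (normalize c) (normalize-Normalized c c≢𝟎))

    Image : Subset (#ℙ r) → Subset (#ℙ n)
    Image A = tabulate (λ k → does (Finₚ.any? (λ k' → (lookup A k' Boolₚ.≟ true) ×-dec (image k' Finₚ.≟ k))))

    Preimage : Subset (#ℙ n) → Subset (#ℙ r)
    Preimage B = tabulate (λ k' → lookup B (image k'))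

    Image-∋⁻ : ∀ A k → lookup (Image A) k ≡ true → Σ (Fin (#ℙ r)) (λ k' → lookup A k' ≡ true × image k' ≡ k)
    Image-∋⁻ A k k∈ with Finₚ.any? (λ k' → (lookup A k' Boolₚ.≟ true) ×-dec (image k' Finₚ.≟ k))
                       | Vecₚ.lookup∘tabulate (λ k → does (Finₚ.any? (λ k' → (lookup A k' Boolₚ.≟ true) ×-dec (image k' Finₚ.≟ k)))) k
    ... | yes found | _  = found
    ... | no _      | e  = case trans (sym k∈) e of λ ()

    Image-∋⁺ : ∀ A k' → lookup A k' ≡ true → lookup (Image A) (image k') ≡ true
    Image-∋⁺ A k' k'∈A with Finₚ.any? (λ k'' → (lookup A k'' Boolₚ.≟ true) ×-dec (image k'' Finₚ.≟ image k'))
                          | Vecₚ.lookup∘tabulate (λ k → does (Finₚ.any? (λ k'' → (lookup A k'' Boolₚ.≟ true) ×-dec (image k'' Finₚ.≟ k)))) (image k')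
    ... | yes _     | e = e
    ... | no ¬found | _ = ⊥-elim (¬found (k' , k'∈A , refl))

    Preimage-Image : ∀ A → Preimage (Image A) ≡ A
    Preimage-Image A = Vec-ext λ k' → trans (Vecₚ.lookup∘tabulate _ k') (ext-Bool
      (λ e → let (k'' , k''∈A , image≡) = Image-∋⁻ A (image k') e in subst (λ z → lookup A z ≡ true) (image-injective image≡) k''∈A)
      (Image-∋⁺ A k'))

    Image-Preimage : ∀ B → (∀ k → lookup B k ≡ true → Span b (pt n k)) → Image (Preimage B) ≡ B
    Image-Preimage B B⊆Span = Vec-ext λ k → ext-Bool
      (λ k∈ → let (k' , k'∈ , image≡k) = Image-∋⁻ (Preimage B) k k∈
              in subst (λ z → lookup B z ≡ true) image≡k (trans (sym (Vecₚ.lookup∘tabulate _ k')) k'∈))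
      (λ k∈B → let (k' , image≡k) = image-onto-Span k (B⊆Span k k∈B)
               in subst (λ z → lookup (Image (Preimage B)) z ≡ true) image≡k
                    (Image-∋⁺ (Preimage B) k' (trans (Vecₚ.lookup∘tabulate _ k') (subst (λ z → lookup B z ≡ true) (sym image≡k) k∈B))))

    Image-injective : ∀ {A A'} → Image A ≡ Image A' → A ≡ A'
    Image-injective {A} {A'} e = trans (sym (Preimage-Image A)) (trans (cong Preimage e) (Preimage-Image A'))

    ∣Image∣ : ∀ A → ∣ Image A ∣ ≡ ∣ A ∣
    ∣Image∣ A = begin
      ∣ Image A ∣                                                      ≡⟨ ∣ Image A ∣≡count ⟩
      count (enumFin (#ℙ n)) (λ k → lookup (Image A) k Boolₚ.≟ true)    ≡⟨ CountAlongMaps.count-bijection (enumFin (#ℙ r)) (enumFin (#ℙ n)) _ _ image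
                                                                             (λ _ _ → image-injective) (Image-∋⁺ A _) (Image-∋⁻ A _) ⟩
      count (enumFin (#ℙ r)) (λ k → lookup A k Boolₚ.≟ true)            ≡⟨ sym ∣ A ∣≡count ⟩
      ∣ A ∣                                                            ∎
      where open ≡-Reasoning

    φ[InSpan] : Subset (#ℙ r) → V n → Set
    φ[InSpan] A u = Σ (V r) λ x → InSpan F r A x × φ x ≡ u

    φ[InSpan]-isSubspace : ∀ A → IsSubspace (φ[InSpan] A)
    φ[InSpan]-isSubspace A = record
      { 0∈ = 𝟎 , 0∈ ⟨A⟩ , lc-𝟎 b
      ; +∈ = λ { (x , x∈A , refl) (y , y∈A , refl) → x ⊕ y , +∈ ⟨A⟩ x∈A y∈A , lc-⊕ x y b }
      ; ·∈ = λ { a (x , x∈A , refl) → a ⊙ x , ·∈ ⟨A⟩ a x∈A , lc-⊙ a x b } }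
      where
      ⟨A⟩ : IsSubspace (InSpan F r A)
      ⟨A⟩ = InSpan-isSubspace r A

    InSpan-Image⇒ : ∀ A {u} → InSpan F n (Image A) u → φ[InSpan] A u
    InSpan-Image⇒ A = InSpan-least n (Image A) (φ[InSpan]-isSubspace A) gens
      where
      gens : ∀ k → lookup (Image A) k ≡ true → φ[InSpan] A (pt n k)
      gens k k∈ with Image-∋⁻ A k k∈
      ... | k' , k'∈A , refl = λ⁻¹ k' ⊙ pt r k' , ·∈ (InSpan-isSubspace r A) _ (InSpan-∋ r A k' k'∈A) , sym (pt-image≡φ k')

    InSpan-Image⇐ : ∀ A {u} → φ[InSpan] A u → InSpan F n (Image A) u
    InSpan-Image⇐ A (x , x∈A , refl) = InSpan-least r A {W = λ x → InSpan F n (Image A) (φ x)} φ⁻¹[⟨ImageA⟩] gens x∈A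
      where
      ⟨ImageA⟩ : IsSubspace (InSpan F n (Image A))
      ⟨ImageA⟩ = InSpan-isSubspace n (Image A)
      φ⁻¹[⟨ImageA⟩] : IsSubspace (λ x → InSpan F n (Image A) (φ x))
      φ⁻¹[⟨ImageA⟩] = record
        { 0∈ = subst (InSpan F n (Image A)) (sym (lc-𝟎 b)) (0∈ ⟨ImageA⟩)
        ; +∈ = λ {x} {y} x∈ y∈ → subst (InSpan F n (Image A)) (sym (lc-⊕ x y b)) (+∈ ⟨ImageA⟩ x∈ y∈)
        ; ·∈ = λ a {x} x∈ → subst (InSpan F n (Image A)) (sym (lc-⊙ a x b)) (·∈ ⟨ImageA⟩ a x∈) }
      gens : ∀ k' → lookup A k' ≡ true → InSpan F n (Image A) (φ (pt r k'))
      gens k' k'∈A = subst (InSpan F n (Image A)) (sym (φ-pt≡⊙pt-image k'))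
                       (·∈ ⟨ImageA⟩ _ (InSpan-∋ n (Image A) (image k') (Image-∋⁺ A k' k'∈A)))

    Spanning : Subset (#ℙ r) → Set
    Spanning A = ∀ x → InSpan F r A x

    spanning? : Decidable Spanning
    spanning? A = ∀V? F r (inSpan? F r A)

    count-SpansSpan : ∀ i → count (enumSubset (#ℙ n)) (λ B → (∣ B ∣ ≟ i) ×-dec spansSpan? b B)
                          ≡ count (enumSubset (#ℙ r)) (λ A → (∣ A ∣ ≟ i) ×-dec spanning? A)
    count-SpansSpan i = CountAlongMaps.count-bijection (enumSubset (#ℙ r)) (enumSubset (#ℙ n)) _ _ Image
                          (λ {A} {A'} _ _ → Image-injective {A} {A'})
                          (λ {A} → Image-SpansSpan {A}) (λ {B} → Preimage-Spanning {B})
      where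
      Image-SpansSpan : ∀ {A} → ∣ A ∣ ≡ i × Spanning A → ∣ Image A ∣ ≡ i × SpansSpan b (Image A)
      Image-SpansSpan {A} (∣A∣≡i , spanning) = trans (∣Image∣ A) ∣A∣≡i , λ u →
        (λ u∈ → let (x , _ , φx≡u) = InSpan-Image⇒ A u∈ in x , φx≡u) ,
        (λ (c , φc≡u) → InSpan-Image⇐ A (c , spanning c , φc≡u))
      Preimage-Spanning : ∀ {B} → ∣ B ∣ ≡ i × SpansSpan b B → Σ (Subset (#ℙ r)) (λ A → (∣ A ∣ ≡ i × Spanning A) × Image A ≡ B)
      Preimage-Spanning {B} (∣B∣≡i , ⟨B⟩≡Span) = Preimage B , (trans (sym (∣Image∣ (Preimage B))) (trans (cong ∣_∣ B≡) ∣B∣≡i) , spanning) , B≡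
        where
        B≡ : Image (Preimage B) ≡ B
        B≡ = Image-Preimage B (λ k k∈B → proj₁ (⟨B⟩≡Span (pt n k)) (InSpan-∋ n B k k∈B))
        spanning : Spanning (Preimage B)
        spanning x = let (y , y∈ , φy≡φx) = InSpan-Image⇒ (Preimage B)
                                              (subst (λ B → InSpan F n B (φ x)) (sym B≡) (proj₂ (⟨B⟩≡Span (φ x)) (x , refl)))
                     in subst (InSpan F r (Preimage B)) (lc-injective b indep φy≡φx) y∈

    count-points-in-Span : count (enumFin (#ℙ n)) (λ k → span? b (pt n k)) ≡ #ℙ r
    count-points-in-Span = begin
      count (enumFin (#ℙ n)) (λ k → span? b (pt n k))
        ≡⟨ CountAlongMaps.count-bijection (enumFin (#ℙ r)) (enumFin (#ℙ n)) (λ _ → yes tt) _ image (λ _ _ → image-injective)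
             (λ {k'} _ → λ⁻¹ k' ⊙ pt r k' , sym (pt-image≡φ k')) (λ {k} k∈ → let (k' , e) = image-onto-Span k k∈ in k' , tt , e) ⟩
      count (enumFin (#ℙ r)) {λ _ → ⊤} (λ _ → yes tt)
        ≡⟨ count-all (enumFin (#ℙ r)) _ (λ _ → tt) ⟩
      length (allFin (#ℙ r))
        ≡⟨ Listₚ.length-tabulate id ⟩
      #ℙ r ∎
      where open ≡-Reasoning

module QArithmetic (q : ℕ) (q≥2 : 2 ≤ q) where

  instance
    q≢0 : NonZero q
    q≢0 = >-nonZero (≤-trans (s≤s z≤n) q≥2)

  prodℕ-cong : ∀ r {f g : ℕ → ℕ} → (∀ ℓ → ℓ < r → f ℓ ≡ g ℓ) → prodℕ r f ≡ prodℕ r g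
  prodℕ-cong zero    e = refl
  prodℕ-cong (suc r) e = cong₂ _*_ (prodℕ-cong r (λ ℓ ℓ<r → e ℓ (m≤n⇒m≤1+n ℓ<r))) (e r ≤-refl)

  prodℕ-unfoldˡ : ∀ r (f : ℕ → ℕ) → prodℕ (suc r) f ≡ f 0 * prodℕ r (f ∘ suc)
  prodℕ-unfoldˡ zero    f = *-comm 1 (f 0)
  prodℕ-unfoldˡ (suc r) f = trans (cong (_* f (suc r)) (prodℕ-unfoldˡ r f)) (*-assoc (f 0) _ _)

  prodℕ-*ˡ : ∀ r (c : ℕ) (f : ℕ → ℕ) → prodℕ r (λ ℓ → c * f ℓ) ≡ c ^ r * prodℕ r f
  prodℕ-*ˡ zero    c f = refl
  prodℕ-*ˡ (suc r) c f = trans (cong (_* (c * f r)) (prodℕ-*ˡ r c f)) (regroup (c ^ r) (prodℕ r f) c (f r))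
    where
    regroup : ∀ a b c d → (a * b) * (c * d) ≡ (c * a) * (b * d)
    regroup = solve-∀

  prodℕ-+ : ∀ j k (f : ℕ → ℕ) → prodℕ (j + k) f ≡ prodℕ j f * prodℕ k (λ ℓ → f (j + ℓ))
  prodℕ-+ j zero    f = trans (cong (λ m → prodℕ m f) (+-identityʳ j)) (sym (*-identityʳ _))
  prodℕ-+ j (suc k) f = trans (cong (λ m → prodℕ m f) (+-suc j k))
                              (trans (cong (_* f (j + k)) (prodℕ-+ j k f)) (*-assoc (prodℕ j f) _ _))

  prodℕ-zero : ∀ r (f : ℕ → ℕ) n → n < r → f n ≡ 0 → prodℕ r f ≡ 0
  prodℕ-zero (suc r) f n n<1+r fn≡0 with n ≟ r
  ... | yes refl = trans (cong (prodℕ r f *_) fn≡0) (*-zeroʳ (prodℕ r f))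
  ... | no n≢r   = cong (_* f r) (prodℕ-zero r f n (≤∧≢⇒< (≤-pred n<1+r) n≢r) fn≡0)

  prodℕ-pos : ∀ r (f : ℕ → ℕ) → (∀ ℓ → ℓ < r → 0 < f ℓ) → 0 < prodℕ r f
  prodℕ-pos zero    f pos = s≤s z≤n
  prodℕ-pos (suc r) f pos = *-mono-< {0} {prodℕ r f} {0} {f r} (prodℕ-pos r f (λ ℓ ℓ<r → pos ℓ (m≤n⇒m≤1+n ℓ<r))) (pos r ≤-refl)

  #indep : ℕ → ℕ → ℕ
  #indep n r = prodℕ r (λ ℓ → q ^ n ∸ q ^ ℓ)

  G : ℕ → ℕ → ℕ
  G = gauss q

  #indep-pos : ∀ r → 0 < #indep r r
  #indep-pos r = prodℕ-pos r _ (λ ℓ ℓ<r → m<n⇒0<n∸m (^-monoʳ-< q q≥2 ℓ<r))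

  #indep-zero : ∀ n r → n < r → #indep n r ≡ 0
  #indep-zero n r n<r = prodℕ-zero r _ n n<r (n∸n≡0 (q ^ n))

  #indep-suc : ∀ n r → #indep (suc n) (suc r) ≡ (q ^ suc n ∸ 1) * (q ^ r * #indep n r)
  #indep-suc n r = trans (prodℕ-unfoldˡ r _) (cong ((q ^ suc n ∸ 1) *_)
    (trans (prodℕ-cong r (λ ℓ _ → sym (*-distribˡ-∸ q (q ^ n) (q ^ ℓ)))) (prodℕ-*ˡ r q _)))

  q^-split : ∀ {r n} → r ≤ n → (q ^ suc r ∸ 1) + q * (q ^ n ∸ q ^ r) ≡ q ^ suc n ∸ 1
  q^-split {r} {n} r≤n = begin
    (q ^ suc r ∸ 1) + q * (q ^ n ∸ q ^ r)          ≡⟨ cong ((q ^ suc r ∸ 1) +_) (*-distribˡ-∸ q (q ^ n) (q ^ r)) ⟩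
    (q ^ suc r ∸ 1) + (q ^ suc n ∸ q ^ suc r)      ≡⟨ +-comm (q ^ suc r ∸ 1) _ ⟩
    (q ^ suc n ∸ q ^ suc r) + (q ^ suc r ∸ 1)      ≡⟨ sym (+-∸-assoc (q ^ suc n ∸ q ^ suc r) (m^n>0 q (suc r))) ⟩
    (q ^ suc n ∸ q ^ suc r) + q ^ suc r ∸ 1        ≡⟨ cong (_∸ 1) (m∸n+n≡m (^-monoʳ-≤ q (s≤s r≤n))) ⟩
    q ^ suc n ∸ 1                                  ∎
    where open ≡-Reasoning

  #indep≡G*#indep : ∀ n r → #indep n r ≡ G n r * #indep r r
  #indep≡G*#indep n       zero    = refl
  #indep≡G*#indep zero    (suc r) = #indep-zero 0 (suc r) (s≤s z≤n)
  #indep≡G*#indep (suc n) (suc r) = sym (begin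
    G (suc n) (suc r) * J₊
      ≡⟨ *-distribʳ-+ J₊ (G n r) (q ^ suc r * G n (suc r)) ⟩
    G n r * J₊ + (q ^ suc r * G n (suc r)) * J₊
      ≡⟨ cong₂ _+_ first second ⟩
    (q ^ suc r ∸ 1) * (q ^ r * #indep n r) + q ^ suc r * (#indep n r * (q ^ n ∸ q ^ r))
      ≡⟨ regroup q (q ^ suc r ∸ 1) (q ^ n ∸ q ^ r) (q ^ r) (#indep n r) ⟩
    ((q ^ suc r ∸ 1) + q * (q ^ n ∸ q ^ r)) * (q ^ r * #indep n r)
      ≡⟨ bracket ⟩
    (q ^ suc n ∸ 1) * (q ^ r * #indep n r)
      ≡⟨ sym (#indep-suc n r) ⟩
    #indep (suc n) (suc r) ∎)
    where
    open ≡-Reasoning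
    J₊ : ℕ
    J₊ = #indep (suc r) (suc r)
    regroup : ∀ q a b c d → a * (c * d) + (q * c) * (d * b) ≡ (a + q * b) * (c * d)
    regroup = solve-∀
    first : G n r * J₊ ≡ (q ^ suc r ∸ 1) * (q ^ r * #indep n r)
    first = begin
      G n r * J₊                                             ≡⟨ cong (G n r *_) (#indep-suc r r) ⟩
      G n r * ((q ^ suc r ∸ 1) * (q ^ r * #indep r r))       ≡⟨ swap (G n r) (q ^ suc r ∸ 1) (q ^ r) (#indep r r) ⟩
      (q ^ suc r ∸ 1) * (q ^ r * (G n r * #indep r r))       ≡⟨ cong (λ x → (q ^ suc r ∸ 1) * (q ^ r * x)) (sym (#indep≡G*#indep n r)) ⟩
      (q ^ suc r ∸ 1) * (q ^ r * #indep n r)                 ∎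
      where
      swap : ∀ a b c d → a * (b * (c * d)) ≡ b * (c * (a * d))
      swap = solve-∀
    second : (q ^ suc r * G n (suc r)) * J₊ ≡ q ^ suc r * (#indep n r * (q ^ n ∸ q ^ r))
    second = trans (*-assoc (q ^ suc r) _ _) (cong (q ^ suc r *_) (sym (#indep≡G*#indep n (suc r))))
    bracket : ((q ^ suc r ∸ 1) + q * (q ^ n ∸ q ^ r)) * (q ^ r * #indep n r) ≡ (q ^ suc n ∸ 1) * (q ^ r * #indep n r)
    bracket with r ≤? n
    ... | yes r≤n = cong (_* (q ^ r * #indep n r)) (q^-split r≤n)
    ... | no r≰n  = trans (vanishes ((q ^ suc r ∸ 1) + q * (q ^ n ∸ q ^ r))) (sym (vanishes (q ^ suc n ∸ 1)))
      where
      vanishes : ∀ a → a * (q ^ r * #indep n r) ≡ 0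
      vanishes a = trans (cong (λ x → a * (q ^ r * x)) (#indep-zero n r (≰⇒> r≰n)))
                         (trans (cong (a *_) (*-zeroʳ (q ^ r))) (*-zeroʳ a))

  G-zero : ∀ n r → n < r → G n r ≡ 0
  G-zero n r n<r with m*n≡0⇒m≡0∨n≡0 (G n r) (trans (sym (#indep≡G*#indep n r)) (#indep-zero n r n<r))
  ... | inj₁ G≡0 = G≡0
  ... | inj₂ J≡0 = ⊥-elim (<-irrefl (sym J≡0) (#indep-pos r))

  G-diag : ∀ r → G r r ≡ 1
  G-diag zero    = refl
  G-diag (suc r) = trans (cong₂ _+_ (G-diag r) (cong (q ^ suc r *_) (G-zero r (suc r) ≤-refl))) (cong suc (*-zeroʳ (q ^ suc r)))

  *-cancelʳ-#indep : ∀ r a b → a * #indep r r ≡ b * #indep r r → a ≡ b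
  *-cancelʳ-#indep r a b = *-cancelʳ-≡ a b (#indep r r) {{>-nonZero (#indep-pos r)}}

  [q-1]*⟨⟩ : ∀ m → (q ∸ 1) * ⟨ m ⟩[ q ] ≡ q ^ m ∸ 1
  [q-1]*⟨⟩ zero    = *-zeroʳ (q ∸ 1)
  [q-1]*⟨⟩ (suc m) = begin
    (q ∸ 1) * (⟨ m ⟩[ q ] + q ^ m)                 ≡⟨ *-distribˡ-+ (q ∸ 1) _ _ ⟩
    (q ∸ 1) * ⟨ m ⟩[ q ] + (q ∸ 1) * q ^ m         ≡⟨ cong₂ _+_ ([q-1]*⟨⟩ m) (*-distribʳ-∸ (q ^ m) q 1) ⟩
    (q ^ m ∸ 1) + (q * q ^ m ∸ 1 * q ^ m)          ≡⟨ cong (λ x → (q ^ m ∸ 1) + (q * q ^ m ∸ x)) (*-identityˡ (q ^ m)) ⟩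
    (q ^ m ∸ 1) + (q * q ^ m ∸ q ^ m)              ≡⟨ +-comm (q ^ m ∸ 1) _ ⟩
    (q * q ^ m ∸ q ^ m) + (q ^ m ∸ 1)              ≡⟨ sym (+-∸-assoc (q * q ^ m ∸ q ^ m) (m^n>0 q m)) ⟩
    (q * q ^ m ∸ q ^ m) + q ^ m ∸ 1                ≡⟨ cong (_∸ 1) (m∸n+n≡m (^-monoʳ-≤ q (n≤1+n m))) ⟩
    q ^ suc m ∸ 1                                  ∎
    where open ≡-Reasoning

  [q-1]*[⟨⟩-⟨⟩] : ∀ n i → (q ∸ 1) * (⟨ n ⟩[ q ] ∸ ⟨ i ⟩[ q ]) ≡ q ^ n ∸ q ^ i
  [q-1]*[⟨⟩-⟨⟩] n i = begin
    (q ∸ 1) * (⟨ n ⟩[ q ] ∸ ⟨ i ⟩[ q ])              ≡⟨ *-distribˡ-∸ (q ∸ 1) _ _ ⟩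
    (q ∸ 1) * ⟨ n ⟩[ q ] ∸ (q ∸ 1) * ⟨ i ⟩[ q ]      ≡⟨ cong₂ _∸_ ([q-1]*⟨⟩ n) ([q-1]*⟨⟩ i) ⟩
    (q ^ n ∸ 1) ∸ (q ^ i ∸ 1)                        ≡⟨ ∸-+-assoc (q ^ n) 1 (q ^ i ∸ 1) ⟩
    q ^ n ∸ (1 + (q ^ i ∸ 1))                        ≡⟨ cong (q ^ n ∸_) (m+[n∸m]≡n (m^n>0 q i)) ⟩
    q ^ n ∸ q ^ i                                    ∎
    where open ≡-Reasoning

module QInversion (q : ℕ) (q≥2 : 2 ≤ q) where
  open import Data.Integer using (ℤ; +_; -_) renaming (_+_ to _+ℤ_; _*_ to _*ℤ_; _^_ to _^ℤ_)
  import Data.Integer.Properties as ℤₚ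
  import Data.Integer.Tactic.RingSolver as ℤ-Solver
  open QArithmetic q q≥2

  sumℤ-cong : ∀ n {f g : ℕ → ℤ} → (∀ j → j ≤ n → f j ≡ g j) → sumℤ n f ≡ sumℤ n g
  sumℤ-cong zero    e = e 0 z≤n
  sumℤ-cong (suc n) e = cong₂ _+ℤ_ (sumℤ-cong n (λ j j≤n → e j (m≤n⇒m≤1+n j≤n))) (e (suc n) ≤-refl)

  sumℤ-zero : ∀ n (f : ℕ → ℤ) → (∀ j → j ≤ n → f j ≡ + 0) → sumℤ n f ≡ + 0
  sumℤ-zero n f e = trans (sumℤ-cong n e) (zeros n)
    where
    zeros : ∀ n → sumℤ n (λ _ → + 0) ≡ + 0
    zeros zero    = refl
    zeros (suc n) = cong (_+ℤ + 0) (zeros n)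

  sumℤ-distrib-+ : ∀ n (f g : ℕ → ℤ) → sumℤ n (λ j → f j +ℤ g j) ≡ sumℤ n f +ℤ sumℤ n g
  sumℤ-distrib-+ zero    f g = refl
  sumℤ-distrib-+ (suc n) f g = trans (cong (_+ℤ (f (suc n) +ℤ g (suc n))) (sumℤ-distrib-+ n f g))
                                     (interchange (sumℤ n f) (sumℤ n g) (f (suc n)) (g (suc n)))
    where
    interchange : ∀ a b c d → (a +ℤ b) +ℤ (c +ℤ d) ≡ (a +ℤ c) +ℤ (b +ℤ d)
    interchange = ℤ-Solver.solve-∀

  sumℤ-*ˡ : ∀ n c (f : ℕ → ℤ) → sumℤ n (λ j → c *ℤ f j) ≡ c *ℤ sumℤ n f
  sumℤ-*ˡ zero    c f = refl
  sumℤ-*ˡ (suc n) c f = trans (cong (_+ℤ c *ℤ f (suc n)) (sumℤ-*ˡ n c f)) (sym (ℤₚ.*-distribˡ-+ c (sumℤ n f) (f (suc n))))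

  sumℤ-comm : ∀ n m (h : ℕ → ℕ → ℤ) → sumℤ n (λ j → sumℤ m (h j)) ≡ sumℤ m (λ k → sumℤ n (λ j → h j k))
  sumℤ-comm zero    m h = refl
  sumℤ-comm (suc n) m h = trans (cong (_+ℤ sumℤ m (h (suc n))) (sumℤ-comm n m h)) (sym (sumℤ-distrib-+ m _ _))

  sumℤ-unfoldˡ : ∀ m (h : ℕ → ℤ) → sumℤ (suc m) h ≡ h 0 +ℤ sumℤ m (h ∘ suc)
  sumℤ-unfoldˡ zero    h = refl
  sumℤ-unfoldˡ (suc m) h = trans (cong (_+ℤ h (suc (suc m))) (sumℤ-unfoldˡ m h)) (ℤₚ.+-assoc (h 0) _ _)

  sumℤ-extend : ∀ m r (h : ℕ → ℤ) → m ≤ r → (∀ k → m < k → k ≤ r → h k ≡ + 0) → sumℤ m h ≡ sumℤ r h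
  sumℤ-extend m zero    h z≤n _ = refl
  sumℤ-extend m (suc r) h m≤1+r vanish with m ≟ suc r
  ... | yes refl = refl
  ... | no m≢1+r = trans (sumℤ-extend m r h (≤-pred m<1+r) (λ k m<k k≤r → vanish k m<k (m≤n⇒m≤1+n k≤r)))
                         (sym (trans (cong (sumℤ r h +ℤ_) (vanish (suc r) m<1+r ≤-refl)) (ℤₚ.+-identityʳ _)))
    where
    m<1+r : m < suc r
    m<1+r = ≤∧≢⇒< m≤1+r m≢1+r

  +-sumℕ : ∀ m (h : ℕ → ℕ) → + sumℕ m h ≡ sumℤ m (λ k → + h k)
  +-sumℕ zero    h = refl
  +-sumℕ (suc m) h = trans (ℤₚ.pos-+ (sumℕ m h) (h (suc m))) (cong (_+ℤ + h (suc m)) (+-sumℕ m h))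

  #indep-+ : ∀ r j k → j ≤ r → #indep r (j + k) ≡ #indep r j * (q ^ (j * k) * #indep (r ∸ j) k)
  #indep-+ r j k j≤r = trans (prodℕ-+ j k _) (cong (#indep r j *_) (begin
    prodℕ k (λ ℓ → q ^ r ∸ q ^ (j + ℓ))             ≡⟨ prodℕ-cong k (λ ℓ _ → factor ℓ) ⟩
    prodℕ k (λ ℓ → q ^ j * (q ^ (r ∸ j) ∸ q ^ ℓ))   ≡⟨ prodℕ-*ˡ k (q ^ j) _ ⟩
    (q ^ j) ^ k * #indep (r ∸ j) k                   ≡⟨ cong (_* #indep (r ∸ j) k) (^-*-assoc q j k) ⟩
    q ^ (j * k) * #indep (r ∸ j) k                   ∎))
    where
    open ≡-Reasoning
    factor : ∀ ℓ → q ^ r ∸ q ^ (j + ℓ) ≡ q ^ j * (q ^ (r ∸ j) ∸ q ^ ℓ)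
    factor ℓ = trans (cong₂ _∸_ (trans (cong (q ^_) (sym (m+[n∸m]≡n j≤r))) (^-distribˡ-+-* q j (r ∸ j)))
                                (^-distribˡ-+-* q j ℓ))
                     (sym (*-distribˡ-∸ (q ^ j) _ _))

  G*G-comm : ∀ r j k → j ≤ r → k ≤ r → G r j * G (r ∸ j) k ≡ G r k * G (r ∸ k) j
  G*G-comm r j k j≤r k≤r = *-cancelʳ-≡ _ _ (X j k) {{>-nonZero (X-pos j k)}} (begin
    G r j * G (r ∸ j) k * X j k      ≡⟨ both-count j k j≤r ⟩
    #indep r (j + k)                 ≡⟨ cong (#indep r) (+-comm j k) ⟩
    #indep r (k + j)                 ≡⟨ sym (both-count k j k≤r) ⟩
    G r k * G (r ∸ k) j * X k j      ≡⟨ cong (G r k * G (r ∸ k) j *_) (X-comm k j) ⟩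
    G r k * G (r ∸ k) j * X j k      ∎)
    where
    open ≡-Reasoning
    X : ℕ → ℕ → ℕ
    X j k = #indep j j * #indep k k * q ^ (j * k)
    X-pos : ∀ j k → 0 < X j k
    X-pos j k = *-mono-< {0} {#indep j j * #indep k k} {0} {q ^ (j * k)}
                  (*-mono-< {0} {#indep j j} {0} {#indep k k} (#indep-pos j) (#indep-pos k)) (m^n>0 q (j * k))
    X-comm : ∀ j k → X j k ≡ X k j
    X-comm j k = cong₂ _*_ (*-comm (#indep j j) _) (cong (q ^_) (*-comm j k))
    both-count : ∀ j k → j ≤ r → G r j * G (r ∸ j) k * X j k ≡ #indep r (j + k)
    both-count j k j≤r = begin
      G r j * G (r ∸ j) k * X j k                                         ≡⟨ regroup (G r j) (G (r ∸ j) k) (#indep j j) (#indep k k) (q ^ (j * k)) ⟩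
      (G r j * #indep j j) * (q ^ (j * k) * (G (r ∸ j) k * #indep k k))    ≡⟨ cong₂ (λ a b → a * (q ^ (j * k) * b)) (sym (#indep≡G*#indep r j)) (sym (#indep≡G*#indep (r ∸ j) k)) ⟩
      #indep r j * (q ^ (j * k) * #indep (r ∸ j) k)                       ≡⟨ sym (#indep-+ r j k j≤r) ⟩
      #indep r (j + k)                                                    ∎
      where
      regroup : ∀ a b c d e → a * b * (c * d * e) ≡ (a * c) * (e * (b * d))
      regroup = solve-∀

  -1ℤ : ℤ
  -1ℤ = - + 1

  α : ℕ → ℤ
  α j = -1ℤ ^ℤ j *ℤ + (q ^ (j C 2))

  α-suc : ∀ j → α (suc j) ≡ -1ℤ *ℤ (+ (q ^ j) *ℤ α j)
  α-suc j = begin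
    (-1ℤ *ℤ -1ℤ ^ℤ j) *ℤ + (q ^ (suc j C 2))           ≡⟨ cong (λ x → (-1ℤ *ℤ -1ℤ ^ℤ j) *ℤ + x) q^C2 ⟩
    (-1ℤ *ℤ -1ℤ ^ℤ j) *ℤ + (q ^ (j C 2) * q ^ j)       ≡⟨ cong ((-1ℤ *ℤ -1ℤ ^ℤ j) *ℤ_) (ℤₚ.pos-* (q ^ (j C 2)) (q ^ j)) ⟩
    (-1ℤ *ℤ -1ℤ ^ℤ j) *ℤ (+ q ^ (j C 2) *ℤ + q ^ j)    ≡⟨ regroup -1ℤ (-1ℤ ^ℤ j) (+ (q ^ (j C 2))) (+ (q ^ j)) ⟩
    -1ℤ *ℤ (+ (q ^ j) *ℤ α j)                          ∎
    where
    open ≡-Reasoning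
    q^C2 : q ^ (suc j C 2) ≡ q ^ (j C 2) * q ^ j
    q^C2 = trans (cong (q ^_) (trans (sym (nCk+nC[k+1]≡[n+1]C[k+1] j 1)) (trans (cong (_+ j C 2) (nC1≡n j)) (+-comm j (j C 2)))))
                 (^-distribˡ-+-* q (j C 2) j)
    regroup : ∀ m p x y → (m *ℤ p) *ℤ (x *ℤ y) ≡ m *ℤ (y *ℤ (p *ℤ x))
    regroup = ℤ-Solver.solve-∀

  ∑α*G : ℕ → ℤ
  ∑α*G m = sumℤ m (λ j → α j *ℤ + G m j)

  α*G-pascal : ∀ m j → α (suc j) *ℤ + G (suc m) (suc j) ≡
                       -1ℤ *ℤ ((+ (q ^ j) *ℤ α j) *ℤ + G m j) +ℤ (+ (q ^ suc j) *ℤ α (suc j)) *ℤ + G m (suc j)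
  α*G-pascal m j = begin
    α (suc j) *ℤ + (G m j + q ^ suc j * G m (suc j))
      ≡⟨ cong (α (suc j) *ℤ_) (trans (ℤₚ.pos-+ (G m j) _) (cong (+ G m j +ℤ_) (ℤₚ.pos-* (q ^ suc j) (G m (suc j))))) ⟩
    α (suc j) *ℤ (+ G m j +ℤ + (q ^ suc j) *ℤ + G m (suc j))
      ≡⟨ cong₂ (λ a x → a *ℤ (+ G m j +ℤ x *ℤ + G m (suc j))) (α-suc j) (ℤₚ.pos-* q (q ^ j)) ⟩
    (-1ℤ *ℤ (+ (q ^ j) *ℤ α j)) *ℤ (+ G m j +ℤ (+ q *ℤ + (q ^ j)) *ℤ + G m (suc j))
      ≡⟨ regroup -1ℤ (+ (q ^ j)) (α j) (+ G m j) (+ q) (+ G m (suc j)) ⟩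
    -1ℤ *ℤ ((+ (q ^ j) *ℤ α j) *ℤ + G m j) +ℤ ((+ q *ℤ + (q ^ j)) *ℤ (-1ℤ *ℤ (+ (q ^ j) *ℤ α j))) *ℤ + G m (suc j)
      ≡⟨ cong₂ (λ x a → -1ℤ *ℤ ((+ (q ^ j) *ℤ α j) *ℤ + G m j) +ℤ (x *ℤ a) *ℤ + G m (suc j))
               (sym (ℤₚ.pos-* q (q ^ j))) (sym (α-suc j)) ⟩
    -1ℤ *ℤ ((+ (q ^ j) *ℤ α j) *ℤ + G m j) +ℤ (+ (q ^ suc j) *ℤ α (suc j)) *ℤ + G m (suc j) ∎
    where
    open ≡-Reasoning
    regroup : ∀ m y a g x g' → (m *ℤ (y *ℤ a)) *ℤ (g +ℤ (x *ℤ y) *ℤ g') ≡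
                                m *ℤ ((y *ℤ a) *ℤ g) +ℤ ((x *ℤ y) *ℤ (m *ℤ (y *ℤ a))) *ℤ g'
    regroup = ℤ-Solver.solve-∀

  ∑α*G-suc : ∀ m → ∑α*G (suc m) ≡ + 0
  ∑α*G-suc m = begin
    ∑α*G (suc m)                                                       ≡⟨ sumℤ-unfoldˡ m _ ⟩
    + 1 +ℤ sumℤ m (λ j → α (suc j) *ℤ + G (suc m) (suc j))             ≡⟨ cong (+ 1 +ℤ_) (sumℤ-cong m (λ j _ → α*G-pascal m j)) ⟩
    + 1 +ℤ sumℤ m (λ j → -1ℤ *ℤ h j +ℤ h (suc j))                      ≡⟨ cong (+ 1 +ℤ_) (sumℤ-distrib-+ m _ _) ⟩
    + 1 +ℤ (sumℤ m (λ j → -1ℤ *ℤ h j) +ℤ X)                            ≡⟨ cong (λ x → + 1 +ℤ (x +ℤ X)) (sumℤ-*ˡ m -1ℤ h) ⟩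
    + 1 +ℤ (-1ℤ *ℤ sumℤ m h +ℤ X)                                      ≡⟨ cong (λ x → + 1 +ℤ (-1ℤ *ℤ x +ℤ X)) (sym ∑h≡1+X) ⟩
    + 1 +ℤ (-1ℤ *ℤ (+ 1 +ℤ X) +ℤ X)                                    ≡⟨ cancel X ⟩
    + 0                                                                ∎
    where
    open ≡-Reasoning
    h : ℕ → ℤ
    h j = (+ (q ^ j) *ℤ α j) *ℤ + G m j
    X : ℤ
    X = sumℤ m (h ∘ suc)
    ∑h≡1+X : + 1 +ℤ X ≡ sumℤ m h
    ∑h≡1+X = begin
      + 1 +ℤ X                  ≡⟨ sym (sumℤ-unfoldˡ m h) ⟩
      sumℤ (suc m) h            ≡⟨ cong (sumℤ m h +ℤ_) last-vanishes ⟩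
      sumℤ m h +ℤ + 0           ≡⟨ ℤₚ.+-identityʳ _ ⟩
      sumℤ m h                  ∎
      where
      last-vanishes : h (suc m) ≡ + 0
      last-vanishes = trans (cong (λ g → (+ (q ^ suc m) *ℤ α (suc m)) *ℤ + g) (G-zero m (suc m) ≤-refl))
                            (ℤₚ.*-zeroʳ (+ (q ^ suc m) *ℤ α (suc m)))
    cancel : ∀ x → + 1 +ℤ (-1ℤ *ℤ (+ 1 +ℤ x) +ℤ x) ≡ + 0
    cancel = ℤ-Solver.solve-∀

  ∑α*G-δ : ∀ r (c : ℕ → ℤ) → sumℤ r (λ k → c k *ℤ ∑α*G (r ∸ k)) ≡ c r
  ∑α*G-δ zero    c = ℤₚ.*-identityʳ (c 0)
  ∑α*G-δ (suc r) c = begin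
    sumℤ r (λ k → c k *ℤ ∑α*G (suc r ∸ k)) +ℤ c (suc r) *ℤ ∑α*G (r ∸ r)
      ≡⟨ cong₂ _+ℤ_ (sumℤ-zero r _ below-diagonal) (cong (λ m → c (suc r) *ℤ ∑α*G m) (n∸n≡0 r)) ⟩
    + 0 +ℤ c (suc r) *ℤ + 1
      ≡⟨ trans (ℤₚ.+-identityˡ _) (ℤₚ.*-identityʳ (c (suc r))) ⟩
    c (suc r) ∎
    where
    open ≡-Reasoning
    below-diagonal : ∀ k → k ≤ r → c k *ℤ ∑α*G (suc r ∸ k) ≡ + 0
    below-diagonal k k≤r = trans (cong (λ m → c k *ℤ ∑α*G m) (+-∸-assoc 1 k≤r))
                                 (trans (cong (c k *ℤ_) (∑α*G-suc (r ∸ k))) (ℤₚ.*-zeroʳ (c k)))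

  module Convolution (g : ℕ → ℕ) (r : ℕ) where
    term : ℕ → ℕ → ℤ
    term j k = (+ G r j *ℤ α j) *ℤ (+ G (r ∸ j) k *ℤ + g k)

    term-symmetric : ∀ j k → j ≤ r → k ≤ r → term j k ≡ (+ g k *ℤ + G r k) *ℤ (α j *ℤ + G (r ∸ k) j)
    term-symmetric j k j≤r k≤r = begin
      (+ G r j *ℤ α j) *ℤ (+ G (r ∸ j) k *ℤ + g k)      ≡⟨ regroup₁ (+ G r j) (α j) (+ G (r ∸ j) k) (+ g k) ⟩
      (α j *ℤ + g k) *ℤ (+ G r j *ℤ + G (r ∸ j) k)      ≡⟨ cong ((α j *ℤ + g k) *ℤ_) (trans (sym (ℤₚ.pos-* (G r j) _))
                                                            (trans (cong +_ (G*G-comm r j k j≤r k≤r)) (ℤₚ.pos-* (G r k) _))) ⟩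
      (α j *ℤ + g k) *ℤ (+ G r k *ℤ + G (r ∸ k) j)      ≡⟨ regroup₂ (α j) (+ g k) (+ G r k) (+ G (r ∸ k) j) ⟩
      (+ g k *ℤ + G r k) *ℤ (α j *ℤ + G (r ∸ k) j)      ∎
      where
      open ≡-Reasoning
      regroup₁ : ∀ x y z w → (x *ℤ y) *ℤ (z *ℤ w) ≡ (y *ℤ w) *ℤ (x *ℤ z)
      regroup₁ = ℤ-Solver.solve-∀
      regroup₂ : ∀ x y z w → (x *ℤ y) *ℤ (z *ℤ w) ≡ (y *ℤ z) *ℤ (x *ℤ w)
      regroup₂ = ℤ-Solver.solve-∀

    column-sum : ∀ k → k ≤ r → sumℤ r (λ j → term j k) ≡ (+ g k *ℤ + G r k) *ℤ ∑α*G (r ∸ k)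
    column-sum k k≤r = begin
      sumℤ r (λ j → term j k)
        ≡⟨ sumℤ-cong r (λ j j≤r → term-symmetric j k j≤r k≤r) ⟩
      sumℤ r (λ j → (+ g k *ℤ + G r k) *ℤ (α j *ℤ + G (r ∸ k) j))
        ≡⟨ sumℤ-*ˡ r (+ g k *ℤ + G r k) _ ⟩
      (+ g k *ℤ + G r k) *ℤ sumℤ r (λ j → α j *ℤ + G (r ∸ k) j)
        ≡⟨ cong ((+ g k *ℤ + G r k) *ℤ_) (sym (sumℤ-extend (r ∸ k) r _ (m∸n≤m r k)
             (λ j r-k<j _ → trans (cong (λ x → α j *ℤ + x) (G-zero (r ∸ k) j r-k<j)) (ℤₚ.*-zeroʳ (α j))))) ⟩
      (+ g k *ℤ + G r k) *ℤ ∑α*G (r ∸ k) ∎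
      where open ≡-Reasoning

    double-sum≡g : sumℤ r (λ j → sumℤ r (term j)) ≡ + g r
    double-sum≡g = begin
      sumℤ r (λ j → sumℤ r (term j))                    ≡⟨ sumℤ-comm r r term ⟩
      sumℤ r (λ k → sumℤ r (λ j → term j k))            ≡⟨ sumℤ-cong r column-sum ⟩
      sumℤ r (λ k → (+ g k *ℤ + G r k) *ℤ ∑α*G (r ∸ k)) ≡⟨ ∑α*G-δ r (λ k → + g k *ℤ + G r k) ⟩
      + g r *ℤ + G r r                                  ≡⟨ cong (λ x → + g r *ℤ + x) (G-diag r) ⟩
      + g r *ℤ + 1                                      ≡⟨ ℤₚ.*-identityʳ (+ g r) ⟩
      + g r                                             ∎
      where open ≡-Reasoning

  q-binomial-inversion : ∀ (g f : ℕ → ℕ) r → (∀ m → m ≤ r → f m ≡ sumℕ m (λ k → G m k * g k)) →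
    + g r ≡ sumℤ r (λ j → ((+ G r j *ℤ -1ℤ ^ℤ j) *ℤ + (q ^ (j C 2))) *ℤ + f (r ∸ j))
  q-binomial-inversion g f r f≡∑G*g = sym (trans (sumℤ-cong r expand) (Convolution.double-sum≡g g r))
    where
    open Convolution g r using (term)
    expand : ∀ j → j ≤ r → ((+ G r j *ℤ -1ℤ ^ℤ j) *ℤ + (q ^ (j C 2))) *ℤ + f (r ∸ j) ≡ sumℤ r (term j)
    expand j j≤r = begin
      ((+ G r j *ℤ -1ℤ ^ℤ j) *ℤ + (q ^ (j C 2))) *ℤ + f (r ∸ j)
        ≡⟨ cong₂ _*ℤ_ (ℤₚ.*-assoc (+ G r j) _ _) (cong +_ (f≡∑G*g (r ∸ j) (m∸n≤m r j))) ⟩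
      (+ G r j *ℤ α j) *ℤ + sumℕ (r ∸ j) (λ k → G (r ∸ j) k * g k)
        ≡⟨ cong ((+ G r j *ℤ α j) *ℤ_) (+-sumℕ (r ∸ j) _) ⟩
      (+ G r j *ℤ α j) *ℤ sumℤ (r ∸ j) (λ k → + (G (r ∸ j) k * g k))
        ≡⟨ cong ((+ G r j *ℤ α j) *ℤ_) (sumℤ-extend (r ∸ j) r _ (m∸n≤m r j)
                                          (λ k r-j<k _ → cong (λ x → + (x * g k)) (G-zero (r ∸ j) k r-j<k))) ⟩
      (+ G r j *ℤ α j) *ℤ sumℤ r (λ k → + (G (r ∸ j) k * g k))
        ≡⟨ sym (sumℤ-*ˡ r (+ G r j *ℤ α j) _) ⟩
      sumℤ r (λ k → (+ G r j *ℤ α j) *ℤ + (G (r ∸ j) k * g k))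
        ≡⟨ sumℤ-cong r (λ k _ → cong ((+ G r j *ℤ α j) *ℤ_) (ℤₚ.pos-* (G (r ∸ j) k) (g k))) ⟩
      sumℤ r (term j) ∎
      where open ≡-Reasoning
module Gamma {q : ℕ} (F : FiniteField q) where
  open Counting
  open Subsets
  open LinearAlgebra F
  open Projective F
  open QArithmetic q q≥2

  module Dim {s} (A : Subset (#ℙ s)) = Dimension (inSpan? F s A) (InSpan-isSubspace s A)

  DimIs : ∀ s → ℕ → Subset (#ℙ s) → Set
  DimIs s r A = countV s (inSpan? F s A) ≡ q ^ r

  dimIs? : ∀ s r → Decidable (DimIs s r)
  dimIs? s r A = countV s (inSpan? F s A) ≟ q ^ r

  γ≡count : ∀ i r s → γ F i r s ≡ count (enumSubset (#ℙ s)) (λ A → (∣ A ∣ ≟ i) ×-dec dimIs? s r A)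
  γ≡count i r s = trans (countSubsets≡count (#ℙ s) (isΓ? F i r s)) (∑-cong (Enumeration.elements (enumSubset (#ℙ s)))
    (λ A → 𝟙-cong (λ (∣A∣≡i , dim) → ∣A∣≡i , Dim.HasDim⇒count A dim) (λ (∣A∣≡i , |⟨A⟩|) → ∣A∣≡i , Dim.count⇒HasDim A |⟨A⟩|) _ _))

  γ-vanishes : ∀ n i r → i < r ⊎ ⟨ n ⟩[ q ] < i → γ F i r n ≡ 0
  γ-vanishes n i r i<r⊎⟨n⟩<i = trans (γ≡count i r n) (count-none (enumSubset (#ℙ n)) _ (impossible i<r⊎⟨n⟩<i))
    where
    impossible : i < r ⊎ ⟨ n ⟩[ q ] < i → ∀ A → ¬ (∣ A ∣ ≡ i × DimIs n r A)
    impossible (inj₁ i<r)  A (refl , |⟨A⟩|≡q^r) = <⇒≱ i<r (q^-cancel-≤ (subst (_≤ q ^ ∣ A ∣) |⟨A⟩|≡q^r (count-InSpan-≤ n A)))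
    impossible (inj₂ ⟨n⟩<i) A (refl , _)        = <⇒≱ ⟨n⟩<i (subst (∣ A ∣ ≤_) (#ℙ≡⟨⟩ n) (Subsetₚ.∣p∣≤n A))

  γ₀₀≡1 : ∀ n → γ F 0 0 n ≡ 1
  γ₀₀≡1 n = trans (countSubsets≡count (#ℙ n) (isΓ? F 0 0 n))
    (count-single (enumSubset (#ℙ n)) (isΓ? F 0 0 n) ∅ (Subsetₚ.∣⊥∣≡0 (#ℙ n) , [] , [] , indep-[] , ⟨∅⟩≡0)
                  (λ A (∣A∣≡0 , _) → ∣∣≡0⇒≡⊥ A ∣A∣≡0))
    where
    ∅ : Subset (#ℙ n)
    ∅ = replicate (#ℙ n) false
    ⟨∅⟩≡0 : ∀ u → InSpan F n ∅ u → Span {r = 0} [] u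
    ⟨∅⟩≡0 u u∈ = [] , InSpan-least n ∅ {W = 𝟎 ≡_} zero-subspace (λ k k∈∅ → case trans (sym (Vecₚ.lookup-replicate k false)) k∈∅ of λ ()) u∈
      where
      zero-subspace : IsSubspace {n} (𝟎 ≡_)
      zero-subspace = record { 0∈ = refl ; +∈ = λ { refl refl → sym (⊕-identityˡ 𝟎) } ; ·∈ = λ { a refl → sym (⊙-zeroʳ a) } }

  module DoubleCounting (i r n : ℕ) where
    As : List (Subset (#ℙ n))
    As = Enumeration.elements (enumSubset (#ℙ n))

    bs : List (Vec (V n) r)
    bs = Enumeration.elements (enumVec (enumV n) r)

    indep? : Decidable (Indep {n} {r})
    indep? = linIndep? F

    ordered-bases : ∀ A → ∑ bs (λ b → 𝟙 (indep? b) * 𝟙 (spansSpan? b A)) ≡ 𝟙 (dimIs? n r A) * #indep r r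
    ordered-bases A with dimIs? n r A
    ... | yes |⟨A⟩|≡q^r = begin
      ∑ bs (λ b → 𝟙 (indep? b) * 𝟙 (spansSpan? b A))   ≡⟨ ∑-cong bs (λ b → trans (sym (𝟙-× (indep? b) (spansSpan? b A)))
                                                              (𝟙-cong basis⇒tuple tuple⇒basis _ (T.indepIn? b))) ⟩
      count (enumVec (enumV n) r) T.indepIn?            ≡⟨ T.count-IndepIn r ⟩
      #indep r r                                        ≡⟨ sym (+-identityʳ _) ⟩
      1 * #indep r r                                    ∎
      where
      open ≡-Reasoning
      module T = IndependentTuples (inSpan? F n A) (InSpan-isSubspace n A) {r} |⟨A⟩|≡q^r
      basis⇒tuple : ∀ {b} → Indep b × SpansSpan b A → T.IndepIn b
      basis⇒tuple {b} (indep , ⟨A⟩≡Span) = indep , All.map (λ {u} → proj₂ (⟨A⟩≡Span u)) (Span-∋ b)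
      tuple⇒basis : ∀ {b} → T.IndepIn b → Indep b × SpansSpan b A
      tuple⇒basis {b} (indep , b⊆⟨A⟩) = indep , λ u → ⟨A⟩⊆Span u , λ { (c , refl) → lc-∈ (InSpan-isSubspace n A) c b b⊆⟨A⟩ }
        where
        ⟨A⟩⊆Span : ∀ u → InSpan F n A u → Span b u
        ⟨A⟩⊆Span = count-≤⇒⊇ (enumV n) (span? b) (inSpan? F n A) (λ { u (c , refl) → lc-∈ (InSpan-isSubspace n A) c b b⊆⟨A⟩ })
                     (≤-reflexive (trans |⟨A⟩|≡q^r (sym (count-Span b indep))))
    ... | no |⟨A⟩|≢q^r = trans (∑-cong bs (λ b → trans (sym (𝟙-× (indep? b) (spansSpan? b A))) (𝟙-no not-basis _))) (∑-zero bs)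
      where
      not-basis : ∀ {b} → ¬ (Indep b × SpansSpan b A)
      not-basis {b} (indep , ⟨A⟩≡Span) =
        |⟨A⟩|≢q^r (trans (count-cong (enumV n) _ (span? b) (proj₁ ∘ ⟨A⟩≡Span) (proj₂ ∘ ⟨A⟩≡Span)) (count-Span b indep))

    spanning-sets : ∀ b → ∑ As (λ A → 𝟙 (∣ A ∣ ≟ i) * (𝟙 (indep? b) * 𝟙 (spansSpan? b A))) ≡ 𝟙 (indep? b) * γ F i r r
    spanning-sets b with indep? b
    ... | no _ = trans (∑-cong As (λ A → *-zeroʳ (𝟙 (∣ A ∣ ≟ i)))) (∑-zero As)
    ... | yes indep = begin
      ∑ As (λ A → 𝟙 (∣ A ∣ ≟ i) * (1 * 𝟙 (spansSpan? b A)))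
        ≡⟨ ∑-cong As (λ A → trans (cong (𝟙 (∣ A ∣ ≟ i) *_) (*-identityˡ _)) (sym (𝟙-× (∣ A ∣ ≟ i) (spansSpan? b A)))) ⟩
      count (enumSubset (#ℙ n)) (λ A → (∣ A ∣ ≟ i) ×-dec spansSpan? b A)
        ≡⟨ Transport.count-SpansSpan b indep i ⟩
      count (enumSubset (#ℙ r)) (λ A → (∣ A ∣ ≟ i) ×-dec Transport.spanning? b indep A)
        ≡⟨ count-cong (enumSubset (#ℙ r)) _ _ (λ A (∣A∣≡i , spanning) → ∣A∣≡i , countV-all r (inSpan? F r A) spanning)
                                              (λ A (∣A∣≡i , |⟨A⟩|≡q^r) → ∣A∣≡i , DimIs⇒spanning A |⟨A⟩|≡q^r) ⟩
      count (enumSubset (#ℙ r)) (λ A → (∣ A ∣ ≟ i) ×-dec dimIs? r r A)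
        ≡⟨ sym (γ≡count i r r) ⟩
      γ F i r r
        ≡⟨ sym (*-identityˡ _) ⟩
      1 * γ F i r r ∎
      where
      open ≡-Reasoning
      DimIs⇒spanning : ∀ A → DimIs r r A → ∀ x → InSpan F r A x
      DimIs⇒spanning A |⟨A⟩|≡q^r x = count-≤⇒⊇ (enumV r) (inSpan? F r A) (λ _ → yes tt) (λ _ _ → tt)
        (≤-reflexive (trans (countV-all r _ (λ _ → tt)) (sym |⟨A⟩|≡q^r))) x tt

    count-indep : ∑ bs (λ b → 𝟙 (indep? b)) ≡ #indep n r
    count-indep = trans (∑-cong bs (λ b → 𝟙-cong (λ indep → indep , all-⊤ b) proj₁ (indep? b) (T.indepIn? b)))
                        (T.count-IndepIn r)
      where
      everything : IsSubspace {n} (λ _ → ⊤)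
      everything = record { 0∈ = tt ; +∈ = λ _ _ → tt ; ·∈ = λ _ _ → tt }
      module T = IndependentTuples (λ _ → yes tt) everything {n} (countV-all n (λ _ → yes tt) (λ _ → tt))
      all-⊤ : ∀ {ℓ} (b : Vec (V n) ℓ) → All (λ _ → ⊤) b
      all-⊤ b = Allₚ.lookup⁻ (λ _ → tt)

    double-count : γ F i r n * #indep r r ≡ #indep n r * γ F i r r
    double-count = begin
      γ F i r n * #indep r r
        ≡⟨ cong (_* #indep r r) (γ≡count i r n) ⟩
      count (enumSubset (#ℙ n)) (λ A → (∣ A ∣ ≟ i) ×-dec dimIs? n r A) * #indep r r
        ≡⟨ sym (∑-*ʳ As (#indep r r) _) ⟩
      ∑ As (λ A → 𝟙 ((∣ A ∣ ≟ i) ×-dec dimIs? n r A) * #indep r r)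
        ≡⟨ ∑-cong As (λ A → trans (cong (_* #indep r r) (𝟙-× (∣ A ∣ ≟ i) (dimIs? n r A)))
                                  (trans (*-assoc (𝟙 (∣ A ∣ ≟ i)) _ _) (cong (𝟙 (∣ A ∣ ≟ i) *_) (sym (ordered-bases A))))) ⟩
      ∑ As (λ A → 𝟙 (∣ A ∣ ≟ i) * ∑ bs (λ b → 𝟙 (indep? b) * 𝟙 (spansSpan? b A)))
        ≡⟨ ∑-cong As (λ A → sym (∑-*ˡ bs (𝟙 (∣ A ∣ ≟ i)) _)) ⟩
      ∑ As (λ A → ∑ bs (λ b → 𝟙 (∣ A ∣ ≟ i) * (𝟙 (indep? b) * 𝟙 (spansSpan? b A))))
        ≡⟨ ∑-comm As bs _ ⟩
      ∑ bs (λ b → ∑ As (λ A → 𝟙 (∣ A ∣ ≟ i) * (𝟙 (indep? b) * 𝟙 (spansSpan? b A))))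
        ≡⟨ ∑-cong bs spanning-sets ⟩
      ∑ bs (λ b → 𝟙 (indep? b) * γ F i r r)
        ≡⟨ ∑-*ʳ bs (γ F i r r) _ ⟩
      ∑ bs (λ b → 𝟙 (indep? b)) * γ F i r r
        ≡⟨ cong (_* γ F i r r) count-indep ⟩
      #indep n r * γ F i r r ∎
      where open ≡-Reasoning

  γ≡G*γ : ∀ i r n → γ F i r n ≡ gauss q n r * γ F i r r
  γ≡G*γ i r n = *-cancelʳ-#indep r (γ F i r n) (gauss q n r * γ F i r r) (begin
    γ F i r n * #indep r r                    ≡⟨ DoubleCounting.double-count i r n ⟩
    #indep n r * γ F i r r                    ≡⟨ cong (_* γ F i r r) (#indep≡G*#indep n r) ⟩
    gauss q n r * #indep r r * γ F i r r      ≡⟨ swap (gauss q n r) (#indep r r) (γ F i r r) ⟩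
    gauss q n r * γ F i r r * #indep r r      ∎)
    where
    open ≡-Reasoning
    swap : ∀ a b c → a * b * c ≡ a * c * b
    swap = solve-∀

  ∑G*γ≡C : ∀ n i → sumℕ n (λ j → gauss q n j * γ F i j j) ≡ ⟨ n ⟩[ q ] C i
  ∑G*γ≡C n i = begin
    sumℕ n (λ j → gauss q n j * γ F i j j)
      ≡⟨ sumℕ-cong n (λ j _ → trans (sym (γ≡G*γ i j n)) (γ≡count i j n)) ⟩
    sumℕ n (λ j → ∑ As (λ A → 𝟙 ((∣ A ∣ ≟ i) ×-dec dimIs? n j A)))
      ≡⟨ sumℕ-∑-comm n As _ ⟩
    ∑ As (λ A → sumℕ n (λ j → 𝟙 ((∣ A ∣ ≟ i) ×-dec dimIs? n j A)))
      ≡⟨ ∑-cong As (λ A → trans (sumℕ-cong n (λ j _ → 𝟙-× (∣ A ∣ ≟ i) (dimIs? n j A)))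
                                (trans (sumℕ-*ˡ n (𝟙 (∣ A ∣ ≟ i)) (λ j → 𝟙 (dimIs? n j A))) (trans (cong (𝟙 (∣ A ∣ ≟ i) *_) (unique-dimension A)) (*-identityʳ _)))) ⟩
    count (enumSubset (#ℙ n)) (λ A → ∣ A ∣ ≟ i)
      ≡⟨ count-∣∣≡ (#ℙ n) i ⟩
    #ℙ n C i
      ≡⟨ cong (_C i) (#ℙ≡⟨⟩ n) ⟩
    ⟨ n ⟩[ q ] C i ∎
    where
    open ≡-Reasoning
    As : List (Subset (#ℙ n))
    As = Enumeration.elements (enumSubset (#ℙ n))
    unique-dimension : ∀ A → sumℕ n (λ j → 𝟙 (dimIs? n j A)) ≡ 1
    unique-dimension A with Dim.dimension A
    ... | m , m≤n , |⟨A⟩|≡q^m = trans (sumℕ-cong n (λ j _ → 𝟙-cong (λ |⟨A⟩|≡q^j → q^-injective (trans (sym |⟨A⟩|≡q^j) |⟨A⟩|≡q^m))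
                                                                (λ { refl → |⟨A⟩|≡q^m }) (dimIs? n j A) (j ≟ m)))
                                      (sumℕ-𝟙-≟ n m m≤n)

  count-InSpan-[]≔true : ∀ n (B : Subset (#ℙ n)) k → ¬ InSpan F n B (pt n k) →
                         countV n (inSpan? F n (B [ k ]≔ true)) ≡ q * countV n (inSpan? F n B)
  count-InSpan-[]≔true n B k p∉⟨B⟩ with Dim.basis B
  ... | m , b , b⊆⟨B⟩ , indep , ⟨B⟩⊆Span = trans (Dim.HasDim⇒count B' extended-basis)
                                               (cong (q *_) (sym (Dim.HasDim⇒count B (b , b⊆⟨B⟩ , indep , ⟨B⟩⊆Span))))
    where
    B' : Subset (#ℙ n)
    B' = B [ k ]≔ true
    p : V n
    p = pt n k
    B⊆B' : ∀ k' → lookup B k' ≡ true → lookup B' k' ≡ true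
    B⊆B' k' k'∈B with k' Finₚ.≟ k
    ... | yes refl = Vecₚ.lookup∘update k B true
    ... | no k'≢k  = trans (Vecₚ.lookup∘update′ k'≢k B true) k'∈B
    extended-basis : HasDim F n (InSpan F n B') (inSpan? F n B') (suc m)
    extended-basis =
      p ∷ b ,
      InSpan-∋ n B' k (Vecₚ.lookup∘update k B true) ∷ All.map (InSpan-mono n B B' B⊆B') b⊆⟨B⟩ ,
      indep-∷⁺ p b indep (λ (c , e) → p∉⟨B⟩ (subst (InSpan F n B) e (lc-∈ (InSpan-isSubspace n B) c b b⊆⟨B⟩))) ,
      λ u u∈⟨B'⟩ → let (a , x , x∈⟨B⟩ , x+ap≡u) = InSpan-[]≔true⇒InSpanWith n B k u∈⟨B'⟩
                       (c , lc≡x) = ⟨B⟩⊆Span x x∈⟨B⟩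
                   in a ∷ c , trans (cong (a ⊙ p ⊕_) lc≡x) (trans (⊕-comm _ _) x+ap≡u)

  count-points-in-InSpan : ∀ n B i → DimIs n i B → count (enumFin (#ℙ n)) (λ k → inSpan? F n B (pt n k)) ≡ #ℙ i
  count-points-in-InSpan n B i |⟨B⟩|≡q^i with Dim.count⇒HasDim B {i} |⟨B⟩|≡q^i
  ... | b , b⊆⟨B⟩ , indep , ⟨B⟩⊆Span = trans
    (count-cong (enumFin (#ℙ n)) _ (λ k → span? b (pt n k)) (λ k → ⟨B⟩⊆Span (pt n k))
                (λ k (c , e) → subst (InSpan F n B) e (lc-∈ (InSpan-isSubspace n B) c b b⊆⟨B⟩)))
    (Transport.count-points-in-Span {n} {i} b indep)

  module IndependentPointSets (n : ℕ) where
    Pointed : Set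
    Pointed = Subset (#ℙ n) × Fin (#ℙ n)

    enumPointed : Enumeration Pointed
    enumPointed = enum× (enumSubset (#ℙ n)) (enumFin (#ℙ n))

    independent? : ∀ i → Decidable (λ A → ∣ A ∣ ≡ i × DimIs n i A)
    independent? i A = (∣ A ∣ ≟ i) ×-dec dimIs? n i A

    count-fibred : {P : Subset (#ℙ n) → Set} {Q : Subset (#ℙ n) → Fin (#ℙ n) → Set}
                   (P? : Decidable P) (Q? : ∀ A → Decidable (Q A)) (c : ℕ) →
                   (∀ A → P A → count (enumFin (#ℙ n)) (Q? A) ≡ c) →
                   count enumPointed (λ (A , k) → P? A ×-dec Q? A k) ≡ count (enumSubset (#ℙ n)) P? * c
    count-fibred P? Q? c fibre = begin
      count enumPointed (λ (A , k) → P? A ×-dec Q? A k)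
        ≡⟨ ∑-pairs (enumSubset (#ℙ n)) (enumFin (#ℙ n)) _,_ _ ⟩
      ∑ As (λ A → ∑ (allFin (#ℙ n)) (λ k → 𝟙 (P? A ×-dec Q? A k)))
        ≡⟨ ∑-cong As (λ A → trans (∑-cong (allFin (#ℙ n)) (λ k → 𝟙-× (P? A) (Q? A k))) (∑-*ˡ (allFin (#ℙ n)) (𝟙 (P? A)) (λ k → 𝟙 (Q? A k)))) ⟩
      ∑ As (λ A → 𝟙 (P? A) * count (enumFin (#ℙ n)) (Q? A))
        ≡⟨ ∑-cong As (λ A → 𝟙-*-cong (P? A) (fibre A)) ⟩
      ∑ As (λ A → 𝟙 (P? A) * c)
        ≡⟨ ∑-*ʳ As c _ ⟩
      count (enumSubset (#ℙ n)) P? * c ∎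
      where
      open ≡-Reasoning
      As : List (Subset (#ℙ n))
      As = Enumeration.elements (enumSubset (#ℙ n))

    marked? : ∀ i → Decidable (λ ((A , k) : Pointed) → (∣ A ∣ ≡ suc i × DimIs n (suc i) A) × lookup A k ≡ true)
    marked? i (A , k) = independent? (suc i) A ×-dec (lookup A k Boolₚ.≟ true)

    extendable? : ∀ i → Decidable (λ ((B , k) : Pointed) → (∣ B ∣ ≡ i × DimIs n i B) ×
                                                            (lookup B k ≡ false × ¬ InSpan F n B (pt n k)))
    extendable? i (B , k) = independent? i B ×-dec ((lookup B k Boolₚ.≟ false) ×-dec ¬? (inSpan? F n B (pt n k)))

    count-marked : ∀ i → count enumPointed (marked? i) ≡ γ F (suc i) (suc i) n * suc i
    count-marked i = begin
      count enumPointed (marked? i)                                          ≡⟨ count-fibred (independent? (suc i)) (λ A k → lookup A k Boolₚ.≟ true) (suc i)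
                                                                                  (λ A (∣A∣≡1+i , _) → trans (sym ∣ A ∣≡count) ∣A∣≡1+i) ⟩
      count (enumSubset (#ℙ n)) (independent? (suc i)) * suc i               ≡⟨ cong (_* suc i) (sym (γ≡count (suc i) (suc i) n)) ⟩
      γ F (suc i) (suc i) n * suc i                                          ∎
      where open ≡-Reasoning

    count-extendable : ∀ i → count enumPointed (extendable? i) ≡ γ F i i n * (#ℙ n ∸ #ℙ i)
    count-extendable i = begin
      count enumPointed (extendable? i)                    ≡⟨ count-fibred (independent? i) _ (#ℙ n ∸ #ℙ i) outside-span ⟩
      count (enumSubset (#ℙ n)) (independent? i) * (#ℙ n ∸ #ℙ i)   ≡⟨ cong (_* (#ℙ n ∸ #ℙ i)) (sym (γ≡count i i n)) ⟩
      γ F i i n * (#ℙ n ∸ #ℙ i)                            ∎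
      where
      open ≡-Reasoning
      outside-span : ∀ B → ∣ B ∣ ≡ i × DimIs n i B →
                     count (enumFin (#ℙ n)) (λ k → (lookup B k Boolₚ.≟ false) ×-dec ¬? (inSpan? F n B (pt n k))) ≡ #ℙ n ∸ #ℙ i
      outside-span B (_ , |⟨B⟩|≡q^i) = begin
        count (enumFin (#ℙ n)) (λ k → (lookup B k Boolₚ.≟ false) ×-dec ¬? (inSpan? F n B (pt n k)))
          ≡⟨ count-cong (enumFin (#ℙ n)) _ outside? (λ _ (_ , p∉) → tt , p∉) (λ k (_ , p∉) → k∉B k p∉ , p∉) ⟩
        count (enumFin (#ℙ n)) outside?
          ≡⟨ sym (m+n∸m≡n (#ℙ i) _) ⟩
        #ℙ i + count (enumFin (#ℙ n)) outside? ∸ #ℙ i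
          ≡⟨ cong (λ x → x + count (enumFin (#ℙ n)) outside? ∸ #ℙ i) (sym (trans (count-cong (enumFin (#ℙ n)) _ _ (λ _ → proj₂) (λ _ → tt ,_))
                                                                                 (count-points-in-InSpan n B i |⟨B⟩|≡q^i))) ⟩
        count (enumFin (#ℙ n)) inside? + count (enumFin (#ℙ n)) outside? ∸ #ℙ i
          ≡⟨ cong (_∸ #ℙ i) (sym (count-split (enumFin (#ℙ n)) (λ _ → yes tt) (λ k → inSpan? F n B (pt n k)))) ⟩
        count (enumFin (#ℙ n)) {λ _ → ⊤} (λ _ → yes tt) ∸ #ℙ i
          ≡⟨ cong (_∸ #ℙ i) (trans (count-all (enumFin (#ℙ n)) _ (λ _ → tt)) (Listₚ.length-tabulate id)) ⟩
        #ℙ n ∸ #ℙ i ∎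
        where
        inside? : Decidable (λ k → ⊤ × InSpan F n B (pt n k))
        inside? k = yes tt ×-dec inSpan? F n B (pt n k)
        outside? : Decidable (λ k → ⊤ × ¬ InSpan F n B (pt n k))
        outside? k = yes tt ×-dec ¬? (inSpan? F n B (pt n k))
        k∉B : ∀ k → ¬ InSpan F n B (pt n k) → lookup B k ≡ false
        k∉B k p∉⟨B⟩ with lookup B k in e
        ... | true  = ⊥-elim (p∉⟨B⟩ (InSpan-∋ n B k e))
        ... | false = refl

    unmark : Pointed → Pointed
    unmark (A , k) = A [ k ]≔ false , k

    unmark-injective : ∀ {A k A' k'} → lookup A k ≡ true → lookup A' k' ≡ true →
                       unmark (A , k) ≡ unmark (A' , k') → (A , k) ≡ (A' , k')
    unmark-injective {A} {k} {A'} k∈A k∈A' e with cong proj₂ e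
    ... | refl = cong (_, k) (begin
      A                           ≡⟨ sym ([]≔-restore A k k∈A) ⟩
      A [ k ]≔ false [ k ]≔ true   ≡⟨ cong (_[ k ]≔ true) (cong proj₁ e) ⟩
      A' [ k ]≔ false [ k ]≔ true  ≡⟨ []≔-restore A' k k∈A' ⟩
      A'                          ∎)
      where open ≡-Reasoning

    unmark-extendable : ∀ i A k → ∣ A ∣ ≡ suc i × DimIs n (suc i) A → lookup A k ≡ true →
                        (∣ A [ k ]≔ false ∣ ≡ i × DimIs n i (A [ k ]≔ false)) ×
                        (lookup (A [ k ]≔ false) k ≡ false × ¬ InSpan F n (A [ k ]≔ false) (pt n k))
    unmark-extendable i A k (∣A∣≡1+i , |⟨A⟩|≡q^1+i) k∈A = (∣B∣≡i , |⟨B⟩|≡q^i) , k∉B , p∉⟨B⟩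
      where
      B : Subset (#ℙ n)
      B = A [ k ]≔ false
      k∉B : lookup B k ≡ false
      k∉B = Vecₚ.lookup∘update k A false
      B+k≡A : B [ k ]≔ true ≡ A
      B+k≡A = []≔-restore A k k∈A
      ∣B∣≡i : ∣ B ∣ ≡ i
      ∣B∣≡i = suc-injective (trans (sym (∣[]≔true∣ B k k∉B)) (trans (cong ∣_∣ B+k≡A) ∣A∣≡1+i))
      p∉⟨B⟩ : ¬ InSpan F n B (pt n k)
      p∉⟨B⟩ p∈⟨B⟩ = <⇒≱ (^-monoʳ-< q q≥2 (n<1+n i)) (begin
        q ^ suc i                     ≡⟨ sym |⟨A⟩|≡q^1+i ⟩
        countV n (inSpan? F n A)      ≤⟨ count-mono (enumV n) _ (inSpan? F n B) ⟨A⟩⊆⟨B⟩ ⟩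
        countV n (inSpan? F n B)      ≤⟨ count-InSpan-≤ n B ⟩
        q ^ ∣ B ∣                     ≡⟨ cong (q ^_) ∣B∣≡i ⟩
        q ^ i                         ∎)
        where
        open ≤-Reasoning
        ⟨A⟩⊆⟨B⟩ : ∀ u → InSpan F n A u → InSpan F n B u
        ⟨A⟩⊆⟨B⟩ u u∈⟨A⟩ = let (a , x , x∈⟨B⟩ , x+ap≡u) = InSpan-[]≔true⇒InSpanWith n B k (subst (λ X → InSpan F n X u) (sym B+k≡A) u∈⟨A⟩)
                          in subst (InSpan F n B) x+ap≡u (+∈ (InSpan-isSubspace n B) x∈⟨B⟩ (·∈ (InSpan-isSubspace n B) a p∈⟨B⟩))
      |⟨B⟩|≡q^i : DimIs n i B
      |⟨B⟩|≡q^i = *-cancelˡ-≡ _ _ q (begin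
        q * countV n (inSpan? F n B)         ≡⟨ sym (count-InSpan-[]≔true n B k p∉⟨B⟩) ⟩
        countV n (inSpan? F n (B [ k ]≔ true)) ≡⟨ cong (λ X → countV n (inSpan? F n X)) B+k≡A ⟩
        countV n (inSpan? F n A)             ≡⟨ |⟨A⟩|≡q^1+i ⟩
        q * q ^ i                            ∎)
        where open ≡-Reasoning

    mark : ∀ i B k → ∣ B ∣ ≡ i × DimIs n i B → lookup B k ≡ false → ¬ InSpan F n B (pt n k) →
           (∣ B [ k ]≔ true ∣ ≡ suc i × DimIs n (suc i) (B [ k ]≔ true)) × lookup (B [ k ]≔ true) k ≡ true
    mark i B k (∣B∣≡i , |⟨B⟩|≡q^i) k∉B p∉⟨B⟩ =
      (trans (∣[]≔true∣ B k k∉B) (cong suc ∣B∣≡i) , trans (count-InSpan-[]≔true n B k p∉⟨B⟩) (cong (q *_) |⟨B⟩|≡q^i)) ,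
      Vecₚ.lookup∘update k B true

    γ-recursion : ∀ i → γ F (suc i) (suc i) n * suc i ≡ γ F i i n * (#ℙ n ∸ #ℙ i)
    γ-recursion i = begin
      γ F (suc i) (suc i) n * suc i          ≡⟨ sym (count-marked i) ⟩
      count enumPointed (marked? i)          ≡⟨ sym (CountAlongMaps.count-bijection enumPointed enumPointed (marked? i) (extendable? i) unmark
                                                   (λ (_ , k∈A) (_ , k∈A') → unmark-injective k∈A k∈A')
                                                   (λ {(A , k)} (indep , k∈A) → unmark-extendable i A k indep k∈A)
                                                   (λ {(B , k)} (indep , k∉B , p∉⟨B⟩) → (B [ k ]≔ true , k) , mark i B k indep k∉B p∉⟨B⟩ ,
                                                                                        cong (_, k) ([]≔-restore B k k∉B))) ⟩
      count enumPointed (extendable? i)      ≡⟨ count-extendable i ⟩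
      γ F i i n * (#ℙ n ∸ #ℙ i)              ∎
      where open ≡-Reasoning

    γ-diagonal : ∀ i → (i ! * (q ∸ 1) ^ i) * γ F i i n ≡ prodℕ i (λ ℓ → q ^ n ∸ q ^ ℓ)
    γ-diagonal zero    = trans (+-identityʳ _) (γ₀₀≡1 n)
    γ-diagonal (suc i) = begin
      (suc i ! * (q ∸ 1) ^ suc i) * γ F (suc i) (suc i) n
        ≡⟨ regroup₁ (suc i) (i !) (q ∸ 1) ((q ∸ 1) ^ i) (γ F (suc i) (suc i) n) ⟩
      (i ! * (q ∸ 1) ^ i) * ((q ∸ 1) * (γ F (suc i) (suc i) n * suc i))
        ≡⟨ cong (λ x → (i ! * (q ∸ 1) ^ i) * ((q ∸ 1) * x)) (γ-recursion i) ⟩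
      (i ! * (q ∸ 1) ^ i) * ((q ∸ 1) * (γ F i i n * (#ℙ n ∸ #ℙ i)))
        ≡⟨ regroup₂ (i ! * (q ∸ 1) ^ i) (q ∸ 1) (γ F i i n) (#ℙ n ∸ #ℙ i) ⟩
      ((i ! * (q ∸ 1) ^ i) * γ F i i n) * ((q ∸ 1) * (#ℙ n ∸ #ℙ i))
        ≡⟨ cong₂ _*_ (γ-diagonal i) (trans (cong₂ (λ a b → (q ∸ 1) * (a ∸ b)) (#ℙ≡⟨⟩ n) (#ℙ≡⟨⟩ i)) ([q-1]*[⟨⟩-⟨⟩] n i)) ⟩
      prodℕ (suc i) (λ ℓ → q ^ n ∸ q ^ ℓ) ∎
      where
      open ≡-Reasoning
      regroup₁ : ∀ a b c d e → (a * b * (c * d)) * e ≡ (b * d) * (c * (e * a))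
      regroup₁ = solve-∀
      regroup₂ : ∀ a b c d → a * (b * (c * d)) ≡ (a * c) * (b * d)
      regroup₂ = solve-∀

open import Data.Integer using (ℤ; +_; -_) renaming (_*_ to _*ℤ_; _^_ to _^ℤ_)

proposition5p11 :
    (q : ℕ) (F : FiniteField q) (n : ℕ) → 1 ≤ n → (i r : ℕ) → r ≤ n →
      -- (a)
      ((i < r ⊎ ⟨ n ⟩[ q ] < i → γ F i r n ≡ 0) ×
       γ F 0 0 n ≡ 1 ×
       (n ! * (q ∸ 1) ^ n) * γ F n n n ≡ prodℕ n (λ ℓ → q ^ n ∸ q ^ ℓ)) ×
      -- (b)
      γ F i r n ≡ gauss q n r * γ F i r r ×
      -- (c)
      sumℕ n (λ j → gauss q n j * γ F i j j) ≡ ⟨ n ⟩[ q ] C i ×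
      -- (d)
      + γ F i r r ≡ sumℤ r (λ j → ((+ gauss q r j *ℤ (- + 1) ^ℤ j) *ℤ + (q ^ (j C 2))) *ℤ + (⟨ r ∸ j ⟩[ q ] C i))
proposition5p11 q F n _ i r _ =
  (γ-vanishes n i r , γ₀₀≡1 n , IndependentPointSets.γ-diagonal n n) ,
  γ≡G*γ i r n ,
  ∑G*γ≡C n i ,
  QInversion.q-binomial-inversion q q≥2 (λ j → γ F i j j) (λ m → ⟨ m ⟩[ q ] C i) r (λ m _ → sym (∑G*γ≡C m i))
  where
  open Gamma F
  open LinearAlgebra F using (q≥2)
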